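{- Let $u,v\in\mathbb{P}^\ast$ be words over the positive integers. If $u$ and $v$ are strongly Wilf-equivalent, i.e. $A_u(x,y,z)=A_v(x,y,z)$, then $u$ and $v$ are rearrangements of each other, i.e. $|u|=|v|$ and there is a permutation $\pi$ of $\{1,\dots,|u|\}$ with $v=u_{\pi(1)}u_{\pi(2)}\cdots u_{\pi(|u|)}$.
   Context: $\mathbb{P}$ denotes the positive integers and $\mathbb{P}^\ast$ the set of finite words over $\mathbb{P}$. For a word $w=w_1\cdots w_n$, $|w|=n$ is its length and $\|w\|=w_1+\cdots+w_n$ is the sum of its entries. A word $v$ dominates a word $u$ if $|v|=|u|$ and $v_i\ge u_i$ for all $i$. A factor of $w$ dominating $u$ is a contiguous subword $w_jw_{j+1}\cdots w_{j+|u|-1}$ that dominates $u$; factors at different starting positions are counted separately. Define $A_u(x,y,z)=\sum_{w\in\mathbb{P}^\ast} x^{|w|}y^{\|w\|}z^{N_u(w)}$, where $N_u(w)$ is the number of factors of $w$ dominating $u$. Two words $u,v$ are strongly Wilf-equivalent if $A_u(x,y,z)=A_v(x,y,z)$ as formal power series. -}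

module Defs where

open import Data.Nat using (ℕ; zero; suc; _+_; _≤_; _≤?_)
open import Data.Nat.Properties using ()
open import Data.List using (List; []; _∷_; length; take)
open import Data.Nat.ListAction using (sum)
open import Data.List.Relation.Unary.All using (All)
open import Data.List.Relation.Binary.Pointwise using (Pointwise)
open import Data.List.Relation.Binary.Pointwise.Properties using (decidable)
open import Data.Product using (Σ; _×_)
open import Data.Bool using (if_then_else_)
open import Relation.Nullary using (does)
open import Relation.Binary.PropositionalEquality using (_≡_)
open import Function.Bundles using (_↔_)

Positive : ℕ → Set
Positive a = 1 ≤ a

IsPWord : List ℕ → Set
IsPWord w = All Positive w

-- v dominates u : |v| = |u| and v_i ≥ u_i for all i
-- (Pointwise forces equal length).
Dominates : List ℕ → List ℕ → Set
Dominates v u = Pointwise _≤_ u v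

dominates? : (v u : List ℕ) → Data.Bool.Bool
dominates? v u = does (decidable _≤?_ u v)

-- N u w : number of starting positions j (0 ≤ j ≤ |w|) such that the factor
-- w_j ... w_{j+|u|-1} (of length |u|) dominates u.
-- At position j the candidate factor is  take |u| (drop j w); if the suffix
-- is shorter than |u| it cannot dominate u (lengths differ).
N : List ℕ → List ℕ → ℕ
N u [] = if dominates? [] u then 1 else 0
N u (a ∷ w) = (if dominates? (take (length u) (a ∷ w)) u then 1 else 0) + N u w

-- The set of words counted by the coefficient of x^n y^m z^k in A_u(x,y,z):
-- words w over ℙ with |w| = n, ‖w‖ = m and N_u(w) = k.
Coeff : List ℕ → ℕ → ℕ → ℕ → Set
Coeff u n m k =
  Σ (List ℕ) λ w → IsPWord w × length w ≡ n × sum w ≡ m × N u w ≡ k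

-- Strong Wilf-equivalence: A_u = A_v as formal power series, i.e. for every
-- monomial x^n y^m z^k the two (finite) coefficient sets have the same size,
-- expressed as the existence of a bijection between them.
StronglyWilfEquivalent : List ℕ → List ℕ → Set
StronglyWilfEquivalent u v =
  ∀ (n m k : ℕ) → Coeff u n m k ↔ Coeff v n m k

module Submission where

-- Fix |u| = ℓ and J ≥ 1 starting positions, i.e. words of length L = ℓ + J − 1. Counting pairs (w, S),
-- S an r-set of occurrences in w of factors dominating u, expresses Σ_k C(k, r) [x^L y^m z^k] A_u as
-- Σ_S E_L(m − σ(S)), where σ(S) is the sum of the least word dominating copies of u placed at S and
-- E_L(e) counts compositions of e into L parts; since E_L(0) = 1, A_u determines the multiset of the σ(S).
-- Writing each letter x ≤ T + 1 as 1 + #{i < T : x ≥ i + 2}, Σ_S σ(S) becomes a constant minus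
-- Σ_{p,i} C(μ(p, i), r), where μ(p, i) counts the starting positions whose copy of u leaves position p
-- below level i + 2. So the binomial moments, hence the distribution, of the μ agree for u and v.
-- Going from J = ℓ to J = ℓ + 1 adds a single position covered by a whole copy of u, with
-- μ = ℓ − #{q : u_q ≥ i + 2}; thus u and v have the same number of letters ≥ t for every t.

open import Defs
open import Data.Bool using (Bool; true; false; if_then_else_; not; _∧_; _∨_)
open import Data.Bool.Properties using (T-≡; ∧-conicalˡ; ∧-conicalʳ)
open import Data.Empty using (⊥-elim)
open import Data.Fin using (Fin; zero; suc)
open import Data.Fin.Permutation using (↔⇒≡)
open import Data.List using (List; []; _∷_; [_]; length; map; _++_; filter; replicate; lookup; take; drop; applyUpTo; concat)
open import Data.List.Membership.Propositional using (_∈_)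
open import Data.List.Membership.Propositional.Properties
  using (∈-∃++; ∈-lookup; ∈-filter⁺; ∈-filter⁻; ∈-map⁺; ∈-map⁻; ∈-++⁺ˡ; ∈-++⁺ʳ; ∈-++⁻)
open import Data.List.Properties
  using (length-map; length-replicate; length-take; length-drop; length-applyUpTo; ∷-injectiveˡ; ∷-injectiveʳ; take-[]; take-all; drop-drop)
open import Data.List.Relation.Binary.Disjoint.Propositional using (Disjoint)
open import Data.List.Relation.Binary.Permutation.Propositional using (_↭_; ↭-refl; ↭-prep; ↭-sym; ↭-trans)
import Data.List.Relation.Binary.Permutation.Propositional as Perm
open import Data.List.Relation.Binary.Permutation.Propositional.Properties using (shift)
open import Data.List.Relation.Binary.Pointwise using (Pointwise; []; _∷_; decidable; Pointwise-length)
  renaming (refl to Pointwise-refl)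
open import Data.List.Relation.Unary.All using (All; []; _∷_)
import Data.List.Relation.Unary.All as All
import Data.List.Relation.Unary.All.Properties as All
open import Data.List.Relation.Unary.AllPairs using ([]; _∷_)
open import Data.List.Relation.Unary.Any using (here; there)
import Data.List.Relation.Unary.Any as Any
open import Data.List.Relation.Unary.Unique.Propositional using (Unique)
import Data.List.Relation.Unary.Unique.Propositional.Properties as Unique
open import Data.Nat using (ℕ; zero; suc; _+_; _*_; _∸_; _⊔_; _≤_; _<_; _≡ᵇ_; z≤n; s≤s)
open import Data.Nat.Combinatorics using (_C_; nCn≡1; k>n⇒nCk≡0; nCk+nC[k+1]≡[n+1]C[k+1])
open import Data.Nat.ListAction using (sum)
open import Data.Nat.Properties
open import Algebra.Properties.CommutativeSemigroup +-commutativeSemigroup using (interchange; x∙yz≈y∙xz; xy∙z≈xz∙y)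
open import Data.Product using (Σ; _×_; _,_)
open import Data.Sum using (inj₁; inj₂)
open import Function.Bundles using (_↔_; Inverse; Equivalence; mk↔ₛ′)
open import Function.Properties.Inverse using (↔-sym; ↔-trans)
open import Relation.Binary.Definitions using (tri<; tri≈; tri>)
open import Relation.Binary.PropositionalEquality hiding ([_])
open import Relation.Nullary using (yes; no; ¬_; does)
open import Relation.Nullary.Decidable using (T?; dec-true; dec-false)
open import Relation.Unary using (Decidable)

private variable A B : Set

ind : Bool → ℕ
ind b = if b then 1 else 0

ind≤1 : ∀ b → ind b ≤ 1
ind≤1 true = ≤-refl
ind≤1 false = z≤n

ind-not : ∀ b → ind (not b) + ind b ≡ 1
ind-not true = refl
ind-not false = refl

-- Unlike Data.Nat._≤ᵇ_, this computes by structural recursion on both arguments.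
_≤ᵇ_ : ℕ → ℕ → Bool
zero ≤ᵇ _ = true
suc a ≤ᵇ zero = false
suc a ≤ᵇ suc b = a ≤ᵇ b

≤ᵇ-true : ∀ {a b} → a ≤ b → (a ≤ᵇ b) ≡ true
≤ᵇ-true {zero} _ = refl
≤ᵇ-true {suc a} {suc b} (s≤s a≤b) = ≤ᵇ-true a≤b

≤ᵇ-false : ∀ {a b} → b < a → (a ≤ᵇ b) ≡ false
≤ᵇ-false {suc a} {zero} _ = refl
≤ᵇ-false {suc a} {suc b} (s≤s b<a) = ≤ᵇ-false b<a

≤ᵇ-true⇒≤ : ∀ a b → (a ≤ᵇ b) ≡ true → a ≤ b
≤ᵇ-true⇒≤ zero b _ = z≤n
≤ᵇ-true⇒≤ (suc a) (suc b) e = s≤s (≤ᵇ-true⇒≤ a b e)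

≤ᵇ-false⇒> : ∀ a b → (a ≤ᵇ b) ≡ false → b < a
≤ᵇ-false⇒> (suc a) zero _ = s≤s z≤n
≤ᵇ-false⇒> (suc a) (suc b) e = s≤s (≤ᵇ-false⇒> a b e)

≡ᵇ-refl : ∀ a → (a ≡ᵇ a) ≡ true
≡ᵇ-refl zero = refl
≡ᵇ-refl (suc a) = ≡ᵇ-refl a

≡ᵇ-false : ∀ {a b} → a ≢ b → (a ≡ᵇ b) ≡ false
≡ᵇ-false {zero} {zero} a≢b = ⊥-elim (a≢b refl)
≡ᵇ-false {zero} {suc b} _ = refl
≡ᵇ-false {suc a} {zero} _ = refl
≡ᵇ-false {suc a} {suc b} a≢b = ≡ᵇ-false (λ e → a≢b (cong suc e))

≡ᵇ-true⇒≡ : ∀ a b → (a ≡ᵇ b) ≡ true → a ≡ b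
≡ᵇ-true⇒≡ zero zero _ = refl
≡ᵇ-true⇒≡ (suc a) (suc b) e = cong suc (≡ᵇ-true⇒≡ a b e)

≡ᵇ-sym : ∀ a b → (a ≡ᵇ b) ≡ (b ≡ᵇ a)
≡ᵇ-sym zero zero = refl
≡ᵇ-sym zero (suc b) = refl
≡ᵇ-sym (suc a) zero = refl
≡ᵇ-sym (suc a) (suc b) = ≡ᵇ-sym a b

ind-≤ᵇ-suc : ∀ k x → ind (suc k ≤ᵇ x) ≤ ind (k ≤ᵇ x)
ind-≤ᵇ-suc zero zero = z≤n
ind-≤ᵇ-suc zero (suc x) = ≤-refl
ind-≤ᵇ-suc (suc k) zero = z≤n
ind-≤ᵇ-suc (suc k) (suc x) = ind-≤ᵇ-suc k x

≡ᵇ+≤ᵇ : ∀ k x → ind (k ≡ᵇ x) + ind (suc k ≤ᵇ x) ≡ ind (k ≤ᵇ x)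
≡ᵇ+≤ᵇ zero zero = refl
≡ᵇ+≤ᵇ zero (suc x) = refl
≡ᵇ+≤ᵇ (suc k) zero = refl
≡ᵇ+≤ᵇ (suc k) (suc x) = ≡ᵇ+≤ᵇ k x

-- Finite sums

sumMap : (A → ℕ) → List A → ℕ
sumMap f [] = 0
sumMap f (x ∷ xs) = f x + sumMap f xs

Σ< : ℕ → (ℕ → ℕ) → ℕ
Σ< zero f = 0
Σ< (suc n) f = f 0 + Σ< n (λ i → f (suc i))

sumMap-zero : (xs : List A) → sumMap (λ _ → 0) xs ≡ 0
sumMap-zero [] = refl
sumMap-zero (x ∷ xs) = sumMap-zero xs

sumMap-++ : ∀ (f : A → ℕ) xs ys → sumMap f (xs ++ ys) ≡ sumMap f xs + sumMap f ys
sumMap-++ f [] ys = refl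
sumMap-++ f (x ∷ xs) ys = trans (cong (f x +_) (sumMap-++ f xs ys)) (sym (+-assoc (f x) _ _))

sumMap-map : ∀ (f : B → ℕ) (g : A → B) xs → sumMap f (map g xs) ≡ sumMap (λ x → f (g x)) xs
sumMap-map f g [] = refl
sumMap-map f g (x ∷ xs) = cong (f (g x) +_) (sumMap-map f g xs)

sumMap-cong∈ : ∀ {f g : A → ℕ} xs → (∀ x → x ∈ xs → f x ≡ g x) → sumMap f xs ≡ sumMap g xs
sumMap-cong∈ [] h = refl
sumMap-cong∈ (x ∷ xs) h = cong₂ _+_ (h x (here refl)) (sumMap-cong∈ xs (λ y p → h y (there p)))

sumMap-cong : ∀ {f g : A → ℕ} xs → (∀ x → f x ≡ g x) → sumMap f xs ≡ sumMap g xs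
sumMap-cong xs h = sumMap-cong∈ xs (λ x _ → h x)

sumMap-+ : ∀ (f g : A → ℕ) xs → sumMap (λ x → f x + g x) xs ≡ sumMap f xs + sumMap g xs
sumMap-+ f g [] = refl
sumMap-+ f g (x ∷ xs) = trans (cong (f x + g x +_) (sumMap-+ f g xs)) (interchange (f x) (g x) _ _)

sumMap-*ˡ : ∀ c (f : A → ℕ) xs → sumMap (λ x → c * f x) xs ≡ c * sumMap f xs
sumMap-*ˡ c f [] = sym (*-zeroʳ c)
sumMap-*ˡ c f (x ∷ xs) = trans (cong (c * f x +_) (sumMap-*ˡ c f xs)) (sym (*-distribˡ-+ c (f x) _))

sumMap-const : ∀ c (xs : List A) → sumMap (λ _ → c) xs ≡ c * length xs
sumMap-const c [] = sym (*-zeroʳ c)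
sumMap-const c (x ∷ xs) = trans (cong (c +_) (sumMap-const c xs)) (sym (*-suc c (length xs)))

sumMap-swap : ∀ (h : A → B → ℕ) xs ys →
  sumMap (λ x → sumMap (h x) ys) xs ≡ sumMap (λ y → sumMap (λ x → h x y) xs) ys
sumMap-swap h [] ys = sym (sumMap-zero ys)
sumMap-swap h (x ∷ xs) ys = trans (cong (sumMap (h x) ys +_) (sumMap-swap h xs ys))
  (sym (sumMap-+ (h x) (λ y → sumMap (λ x → h x y) xs) ys))

sumMap-Σ< : ∀ (h : A → ℕ → ℕ) xs n →
  sumMap (λ x → Σ< n (h x)) xs ≡ Σ< n (λ i → sumMap (λ x → h x i) xs)
sumMap-Σ< h xs zero = sumMap-zero xs
sumMap-Σ< h xs (suc n) = trans (sumMap-+ (λ x → h x 0) (λ x → Σ< n (λ i → h x (suc i))) xs)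
  (cong (sumMap (λ x → h x 0) xs +_) (sumMap-Σ< (λ x i → h x (suc i)) xs n))

sumMap-↭ : ∀ (f : A → ℕ) {xs ys} → xs ↭ ys → sumMap f xs ≡ sumMap f ys
sumMap-↭ f Perm.refl = refl
sumMap-↭ f (Perm.prep x p) = cong (f x +_) (sumMap-↭ f p)
sumMap-↭ f {x ∷ y ∷ xs} {y ∷ x ∷ ys} (Perm.swap x y p) = begin
  f x + (f y + sumMap f xs) ≡⟨ cong (λ s → f x + (f y + s)) (sumMap-↭ f p) ⟩
  f x + (f y + sumMap f ys) ≡⟨ x∙yz≈y∙xz (f x) (f y) _ ⟩
  f y + (f x + sumMap f ys) ∎
  where
  open ≡-Reasoning
sumMap-↭ f (Perm.trans p q) = trans (sumMap-↭ f p) (sumMap-↭ f q)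

Σ<-cong : ∀ n {f g : ℕ → ℕ} → (∀ i → i < n → f i ≡ g i) → Σ< n f ≡ Σ< n g
Σ<-cong zero h = refl
Σ<-cong (suc n) h = cong₂ _+_ (h 0 (s≤s z≤n)) (Σ<-cong n (λ i lt → h (suc i) (s≤s lt)))

Σ<-+ : ∀ n (f g : ℕ → ℕ) → Σ< n (λ i → f i + g i) ≡ Σ< n f + Σ< n g
Σ<-+ zero f g = refl
Σ<-+ (suc n) f g = trans (cong (f 0 + g 0 +_) (Σ<-+ n (λ i → f (suc i)) (λ i → g (suc i))))
  (interchange (f 0) (g 0) _ _)

Σ<-const : ∀ n c → Σ< n (λ _ → c) ≡ n * c
Σ<-const zero c = refl
Σ<-const (suc n) c = cong (c +_) (Σ<-const n c)

Σ<-zero : ∀ n → Σ< n (λ _ → 0) ≡ 0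
Σ<-zero zero = refl
Σ<-zero (suc n) = Σ<-zero n

Σ<-last : ∀ n f → Σ< (suc n) f ≡ Σ< n f + f n
Σ<-last zero f = +-comm (f 0) 0
Σ<-last (suc n) f = trans (cong (f 0 +_) (Σ<-last n (λ i → f (suc i)))) (sym (+-assoc (f 0) _ _))

Σ<-split : ∀ a b f → Σ< (a + b) f ≡ Σ< a f + Σ< b (λ i → f (a + i))
Σ<-split zero b f = refl
Σ<-split (suc a) b f = trans (cong (f 0 +_) (Σ<-split a b (λ i → f (suc i)))) (sym (+-assoc (f 0) _ _))

Σ<-swap : ∀ m n (h : ℕ → ℕ → ℕ) → Σ< m (λ i → Σ< n (h i)) ≡ Σ< n (λ j → Σ< m (λ i → h i j))
Σ<-swap zero n h = sym (Σ<-zero n)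
Σ<-swap (suc m) n h = trans (cong (Σ< n (h 0) +_) (Σ<-swap m n (λ i → h (suc i))))
  (sym (Σ<-+ n (h 0) (λ j → Σ< m (λ i → h (suc i) j))))

Σ<-select : ∀ n k (g : ℕ → ℕ) → k < n → Σ< n (λ i → ind (i ≡ᵇ k) * g i) ≡ g k
Σ<-select (suc n) zero g _ = trans (cong₂ _+_ (*-identityˡ (g 0)) (Σ<-zero n)) (+-identityʳ (g 0))
Σ<-select (suc n) (suc k) g (s≤s k<n) = Σ<-select n k (λ i → g (suc i)) k<n

Σ<-ind≤ : ∀ n (F : ℕ → Bool) → Σ< n (λ i → ind (F i)) ≤ n
Σ<-ind≤ zero F = z≤n
Σ<-ind≤ (suc n) F = +-mono-≤ (ind≤1 (F 0)) (Σ<-ind≤ n (λ i → F (suc i)))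

Σ<-ind-all : ∀ n (F : ℕ → Bool) → (∀ i → i < n → F i ≡ true) → Σ< n (λ i → ind (F i)) ≡ n
Σ<-ind-all zero F h = refl
Σ<-ind-all (suc n) F h = cong₂ _+_ (cong ind (h 0 (s≤s z≤n)))
  (Σ<-ind-all n (λ i → F (suc i)) (λ i lt → h (suc i) (s≤s lt)))

Σ<-ind-none : ∀ n (F : ℕ → Bool) → (∀ i → i < n → F i ≡ false) → Σ< n (λ i → ind (F i)) ≡ 0
Σ<-ind-none zero F h = refl
Σ<-ind-none (suc n) F h = cong₂ _+_ (cong ind (h 0 (s≤s z≤n)))
  (Σ<-ind-none n (λ i → F (suc i)) (λ i lt → h (suc i) (s≤s lt)))

length-filter : {P : A → Set} (P? : Decidable P) (xs : List A) →
  length (filter P? xs) ≡ sumMap (λ x → ind (does (P? x))) xs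
length-filter P? [] = refl
length-filter P? (x ∷ xs) with does (P? x)
... | true = cong suc (length-filter P? xs)
... | false = length-filter P? xs

sum-applyUpTo : ∀ (f : ℕ → ℕ) n → sum (applyUpTo f n) ≡ Σ< n f
sum-applyUpTo f zero = refl
sum-applyUpTo f (suc n) = cong (f 0 +_) (sum-applyUpTo (λ i → f (suc i)) n)

sumMap-concat : ∀ (f : A → ℕ) xss → sumMap f (concat xss) ≡ sumMap (sumMap f) xss
sumMap-concat f [] = refl
sumMap-concat f (xs ∷ xss) = trans (sumMap-++ f xs (concat xss)) (cong (sumMap f xs +_) (sumMap-concat f xss))

sumMap-applyUpTo : ∀ (f : A → ℕ) (g : ℕ → A) n → sumMap f (applyUpTo g n) ≡ Σ< n (λ i → f (g i))
sumMap-applyUpTo f g zero = refl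
sumMap-applyUpTo f g (suc n) = cong (f (g 0) +_) (sumMap-applyUpTo f (λ i → g (suc i)) n)

sumMap-mono : ∀ {f g : A → ℕ} xs → (∀ x → f x ≤ g x) → sumMap f xs ≤ sumMap g xs
sumMap-mono [] h = z≤n
sumMap-mono (x ∷ xs) h = +-mono-≤ (h x) (sumMap-mono xs h)

-- Multisets of naturals: counts, binomial moments, convolutions

hockey-stick : ∀ x r → x C suc r ≡ Σ< x (λ k → k C r)
hockey-stick zero r = refl
hockey-stick (suc x) r = begin
  suc x C suc r                ≡⟨ sym (nCk+nC[k+1]≡[n+1]C[k+1] x r) ⟩
  x C r + x C suc r            ≡⟨ +-comm (x C r) _ ⟩
  x C suc r + x C r            ≡⟨ cong (_+ x C r) (hockey-stick x r) ⟩
  Σ< x (λ k → k C r) + x C r   ≡⟨ sym (Σ<-last x (λ k → k C r)) ⟩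
  Σ< (suc x) (λ k → k C r)     ∎
  where open ≡-Reasoning

count≡ : ℕ → List ℕ → ℕ
count≡ k = sumMap (λ x → ind (k ≡ᵇ x))

count≥ : ℕ → List ℕ → ℕ
count≥ k = sumMap (λ x → ind (k ≤ᵇ x))

count≡-pos⇒∈ : ∀ k ys → 1 ≤ count≡ k ys → k ∈ ys
count≡-pos⇒∈ k (y ∷ ys) h with k ≡ᵇ y in e
... | true = here (≡ᵇ-true⇒≡ k y e)
... | false = there (count≡-pos⇒∈ k ys h)

count≡-middle : ∀ k a ys zs → count≡ k (ys ++ a ∷ zs) ≡ ind (k ≡ᵇ a) + count≡ k (ys ++ zs)
count≡-middle k a ys zs = sumMap-↭ (λ x → ind (k ≡ᵇ x)) (shift a ys zs)

count≡⇒↭ : ∀ xs ys → (∀ k → count≡ k xs ≡ count≡ k ys) → xs ↭ ys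
count≡⇒↭ [] [] h = ↭-refl
count≡⇒↭ [] (y ∷ ys) h with trans (h y) (cong (λ b → ind b + count≡ y ys) (≡ᵇ-refl y))
... | ()
count≡⇒↭ (a ∷ xs) ys h with ∈-∃++ (count≡-pos⇒∈ a ys (subst (1 ≤_) (h a) a∈a∷xs))
  where
  a∈a∷xs : 1 ≤ count≡ a (a ∷ xs)
  a∈a∷xs = subst (λ b → 1 ≤ ind b + count≡ a xs) (sym (≡ᵇ-refl a)) (s≤s z≤n)
... | ys₁ , ys₂ , refl = ↭-trans (↭-prep a (count≡⇒↭ xs (ys₁ ++ ys₂) h′)) (↭-sym (shift a ys₁ ys₂))
  where
  h′ : ∀ k → count≡ k xs ≡ count≡ k (ys₁ ++ ys₂)
  h′ k = +-cancelˡ-≡ (ind (k ≡ᵇ a)) _ _ (trans (h k) (count≡-middle k a ys₁ ys₂))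

count≡+count≥ : ∀ k xs → count≡ k xs + count≥ (suc k) xs ≡ count≥ k xs
count≡+count≥ k xs = trans (sym (sumMap-+ (λ x → ind (k ≡ᵇ x)) (λ x → ind (suc k ≤ᵇ x)) xs))
  (sumMap-cong xs (≡ᵇ+≤ᵇ k))

count≥⇒↭ : ∀ xs ys → (∀ k → count≥ k xs ≡ count≥ k ys) → xs ↭ ys
count≥⇒↭ xs ys h = count≡⇒↭ xs ys λ k → +-cancelʳ-≡ (count≥ (suc k) xs) _ _ (begin
  count≡ k xs + count≥ (suc k) xs ≡⟨ count≡+count≥ k xs ⟩
  count≥ k xs                     ≡⟨ h k ⟩
  count≥ k ys                     ≡⟨ sym (count≡+count≥ k ys) ⟩
  count≡ k ys + count≥ (suc k) ys ≡⟨ cong (count≡ k ys +_) (sym (h (suc k))) ⟩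
  count≡ k ys + count≥ (suc k) xs ∎)
  where open ≡-Reasoning

moment : ℕ → List ℕ → ℕ
moment r = sumMap (_C r)

Σ<-truncate : ∀ x B (g : ℕ → ℕ) → x ≤ B → Σ< x g ≡ Σ< B (λ k → g k * ind (suc k ≤ᵇ x))
Σ<-truncate x B g x≤B = begin
  Σ< x g                                 ≡⟨ Σ<-cong x (λ k k<x → sym (inside k<x)) ⟩
  Σ< x G                                 ≡⟨ sym (+-identityʳ _) ⟩
  Σ< x G + 0                             ≡⟨ cong (Σ< x G +_) (sym tail≡0) ⟩
  Σ< x G + Σ< (B ∸ x) (λ k → G (x + k))  ≡⟨ sym (Σ<-split x (B ∸ x) G) ⟩
  Σ< (x + (B ∸ x)) G                     ≡⟨ cong (λ n → Σ< n G) (m+[n∸m]≡n x≤B) ⟩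
  Σ< B G                                 ∎
  where
  open ≡-Reasoning
  G : ℕ → ℕ
  G k = g k * ind (suc k ≤ᵇ x)
  inside : ∀ {k} → k < x → G k ≡ g k
  inside {k} k<x = trans (cong (λ b → g k * ind b) (≤ᵇ-true k<x)) (*-identityʳ (g k))
  tail≡0 : Σ< (B ∸ x) (λ k → G (x + k)) ≡ 0
  tail≡0 = trans (Σ<-cong (B ∸ x) (λ k _ → trans (cong (λ b → g (x + k) * ind b) (≤ᵇ-false (s≤s (m≤m+n x k))))
    (*-zeroʳ (g (x + k))))) (Σ<-zero (B ∸ x))

moment-suc : ∀ B r xs → All (_≤ B) xs → moment (suc r) xs ≡ Σ< B (λ k → (k C r) * count≥ (suc k) xs)
moment-suc B r xs xs≤B = begin
  sumMap (_C suc r) xs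
    ≡⟨ sumMap-cong∈ xs (λ x x∈ → trans (hockey-stick x r) (Σ<-truncate x B (_C r) (All.lookup xs≤B x∈))) ⟩
  sumMap (λ x → Σ< B (λ k → (k C r) * ind (suc k ≤ᵇ x))) xs
    ≡⟨ sumMap-Σ< (λ x k → (k C r) * ind (suc k ≤ᵇ x)) xs B ⟩
  Σ< B (λ k → sumMap (λ x → (k C r) * ind (suc k ≤ᵇ x)) xs)
    ≡⟨ Σ<-cong B (λ k _ → sumMap-*ˡ (k C r) (λ x → ind (suc k ≤ᵇ x)) xs) ⟩
  Σ< B (λ k → (k C r) * count≥ (suc k) xs) ∎
  where open ≡-Reasoning

Σ<-count≡ : ∀ K r zs → All (_< K) zs → Σ< K (λ k → (k C r) * count≡ k zs) ≡ moment r zs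
Σ<-count≡ K r zs zs<K = begin
  Σ< K (λ k → (k C r) * count≡ k zs)                     ≡⟨ Σ<-cong K (λ k _ → sym (sumMap-*ˡ (k C r) (λ z → ind (k ≡ᵇ z)) zs)) ⟩
  Σ< K (λ k → sumMap (λ z → (k C r) * ind (k ≡ᵇ z)) zs)  ≡⟨ sym (sumMap-Σ< (λ z k → (k C r) * ind (k ≡ᵇ z)) zs K) ⟩
  sumMap (λ z → Σ< K (λ k → (k C r) * ind (k ≡ᵇ z))) zs  ≡⟨ sumMap-cong∈ zs (λ z z∈ → trans (Σ<-cong K (λ k _ → *-comm (k C r) _))
                                                             (Σ<-select K z (_C r) (All.lookup zs<K z∈))) ⟩
  moment r zs                                            ∎
  where open ≡-Reasoning

binomial-peel : ∀ B k (g : ℕ → ℕ) → k < B →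
  Σ< B (λ j → (j C k) * g j) ≡ g k + Σ< B (λ j → ind (suc k ≤ᵇ j) * ((j C k) * g j))
binomial-peel B k g k<B = begin
  Σ< B (λ j → (j C k) * g j)
    ≡⟨ Σ<-cong B (λ j _ → split j) ⟩
  Σ< B (λ j → ind (j ≡ᵇ k) * g j + ind (suc k ≤ᵇ j) * ((j C k) * g j))
    ≡⟨ Σ<-+ B (λ j → ind (j ≡ᵇ k) * g j) _ ⟩
  Σ< B (λ j → ind (j ≡ᵇ k) * g j) + Σ< B (λ j → ind (suc k ≤ᵇ j) * ((j C k) * g j))
    ≡⟨ cong (_+ Σ< B (λ j → ind (suc k ≤ᵇ j) * ((j C k) * g j))) (Σ<-select B k g k<B) ⟩
  g k + Σ< B (λ j → ind (suc k ≤ᵇ j) * ((j C k) * g j)) ∎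
  where
  open ≡-Reasoning
  split : ∀ j → (j C k) * g j ≡ ind (j ≡ᵇ k) * g j + ind (suc k ≤ᵇ j) * ((j C k) * g j)
  split j with <-cmp j k
  ... | tri< j<k _ _ rewrite k>n⇒nCk≡0 j<k | ≤ᵇ-false {suc k} {j} (m<n⇒m<1+n j<k)
          | ≡ᵇ-false (<⇒≢ j<k) = refl
  ... | tri≈ _ refl _ rewrite nCn≡1 j | ≡ᵇ-refl j | ≤ᵇ-false {suc j} {j} ≤-refl = sym (+-identityʳ _)
  ... | tri> _ _ k<j rewrite ≤ᵇ-true k<j | ≡ᵇ-false (>⇒≢ k<j) = sym (+-identityʳ _)

-- Downward induction on k: the r = k equation determines g k once g j is known for all j > k.
binomial-transform-injective : ∀ B (g h : ℕ → ℕ) →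
  (∀ r → Σ< B (λ j → (j C r) * g j) ≡ Σ< B (λ j → (j C r) * h j)) → ∀ k → k < B → g k ≡ h k
binomial-transform-injective B g h eq k k<B = go (B ∸ k) k (≤-reflexive (sym (m∸n+n≡m (<⇒≤ k<B)))) k<B
  where
  go : ∀ d k → B ≤ d + k → k < B → g k ≡ h k
  go zero k B≤k k<B = ⊥-elim (<⇒≱ k<B B≤k)
  go (suc d) k B≤d+k k<B = +-cancelʳ-≡ _ (g k) (h k) (begin
    g k + Σ< B (λ j → ind (suc k ≤ᵇ j) * ((j C k) * g j)) ≡⟨ sym (binomial-peel B k g k<B) ⟩
    Σ< B (λ j → (j C k) * g j)                           ≡⟨ eq k ⟩
    Σ< B (λ j → (j C k) * h j)                           ≡⟨ binomial-peel B k h k<B ⟩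
    h k + Σ< B (λ j → ind (suc k ≤ᵇ j) * ((j C k) * h j)) ≡⟨ cong (h k +_) (sym (Σ<-cong B above)) ⟩
    h k + Σ< B (λ j → ind (suc k ≤ᵇ j) * ((j C k) * g j)) ∎)
    where
    open ≡-Reasoning
    above : ∀ j → j < B → ind (suc k ≤ᵇ j) * ((j C k) * g j) ≡ ind (suc k ≤ᵇ j) * ((j C k) * h j)
    above j j<B with suc k ≤ᵇ j in e
    ... | false = refl
    ... | true = cong (λ z → 1 * ((j C k) * z)) (go d j B≤d+j j<B)
      where
      B≤d+j : B ≤ d + j
      B≤d+j = ≤-trans B≤d+k (≤-trans (≤-reflexive (sym (+-suc d k))) (+-monoʳ-≤ d (≤ᵇ-true⇒≤ (suc k) j e)))

moments⇒count≥ : ∀ B xs ys → All (_≤ B) xs → All (_≤ B) ys →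
  (∀ r → moment r xs ≡ moment r ys) → ∀ k → count≥ k xs ≡ count≥ k ys
moments⇒count≥ B xs ys xs≤B ys≤B eq zero = eq 0
moments⇒count≥ B xs ys xs≤B ys≤B eq (suc k) with k <? B
... | yes k<B = binomial-transform-injective B (λ j → count≥ (suc j) xs) (λ j → count≥ (suc j) ys)
  (λ r → trans (sym (moment-suc B r xs xs≤B)) (trans (eq (suc r)) (moment-suc B r ys ys≤B))) k k<B
... | no k≮B = trans (none xs xs≤B) (sym (none ys ys≤B))
  where
  none : ∀ zs → All (_≤ B) zs → count≥ (suc k) zs ≡ 0
  none [] _ = refl
  none (z ∷ zs) (z≤B ∷ zs≤B) rewrite ≤ᵇ-false {suc k} {z} (s≤s (≤-trans z≤B (≮⇒≥ k≮B))) = none zs zs≤B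

Antitone : (ℕ → ℕ) → Set
Antitone f = ∀ i → f (suc i) ≤ f i

antitone-≤ : ∀ {f} → Antitone f → ∀ {i j} → i ≤ j → f j ≤ f i
antitone-≤ {f} anti {i} {j} i≤j = subst (λ z → f z ≤ f i) (m∸n+n≡m i≤j) (go (j ∸ i))
  where
  go : ∀ d → f (d + i) ≤ f i
  go zero = ≤-refl
  go (suc d) = ≤-trans (anti (d + i)) (go d)

levelCount : ℕ → ℕ → (ℕ → ℕ) → ℕ
levelCount T k f = Σ< T (λ i → ind (k ≤ᵇ f i))

levelCount-≥ : ∀ {f} → Antitone f → ∀ T k i → i < T → k ≤ f i → suc i ≤ levelCount T k f
levelCount-≥ {f} anti T k i i<T k≤fi = begin
  suc i                                                ≡⟨ sym (Σ<-ind-all (suc i) (λ j → k ≤ᵇ f j) (λ j j≤i → ≤ᵇ-true (k≤f j≤i))) ⟩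
  Σ< (suc i) G                                         ≤⟨ m≤m+n _ _ ⟩
  Σ< (suc i) G + Σ< (T ∸ suc i) (λ j → G (suc i + j))  ≡⟨ sym (Σ<-split (suc i) (T ∸ suc i) G) ⟩
  Σ< (suc i + (T ∸ suc i)) G                           ≡⟨ cong (λ n → Σ< n G) (m+[n∸m]≡n i<T) ⟩
  levelCount T k f                                     ∎
  where
  open ≤-Reasoning
  G : ℕ → ℕ
  G j = ind (k ≤ᵇ f j)
  k≤f : ∀ {j} → j < suc i → k ≤ f j
  k≤f j≤i = ≤-trans k≤fi (antitone-≤ anti (≤-pred j≤i))

levelCount-≤ : ∀ {f} → Antitone f → ∀ T k i → f i < k → levelCount T k f ≤ i
levelCount-≤ {f} anti T k i fi<k with T ≤? i
... | yes T≤i = ≤-trans (Σ<-ind≤ T _) T≤i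
... | no T≰i = begin
  levelCount T k f                          ≡⟨ cong (λ n → Σ< n G) (sym (m+[n∸m]≡n (≰⇒≥ T≰i))) ⟩
  Σ< (i + (T ∸ i)) G                        ≡⟨ Σ<-split i (T ∸ i) G ⟩
  Σ< i G + Σ< (T ∸ i) (λ j → G (i + j))     ≡⟨ cong (Σ< i G +_) tail≡0 ⟩
  Σ< i G + 0                                ≡⟨ +-identityʳ _ ⟩
  Σ< i G                                    ≤⟨ Σ<-ind≤ i _ ⟩
  i                                         ∎
  where
  open ≤-Reasoning
  G : ℕ → ℕ
  G j = ind (k ≤ᵇ f j)
  tail≡0 : Σ< (T ∸ i) (λ j → G (i + j)) ≡ 0
  tail≡0 = Σ<-ind-none (T ∸ i) (λ j → k ≤ᵇ f (i + j))
    (λ j _ → ≤ᵇ-false (≤-<-trans (antitone-≤ anti (m≤m+n i j)) fi<k))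

-- An antitone f is the "inverse" of k ↦ levelCount T k f: f i is the largest k with more than i levels.
antitone-levelCount-injective : ∀ {f g} → Antitone f → Antitone g → ∀ T →
  (∀ k → levelCount T k f ≡ levelCount T k g) → ∀ i → i < T → f i ≡ g i
antitone-levelCount-injective {f} {g} antif antig T eq i i<T =
  ≤-antisym (≤-from antif antig eq) (≤-from antig antif (λ k → sym (eq k)))
  where
  ≤-from : ∀ {f g} → Antitone f → Antitone g → (∀ k → levelCount T k f ≡ levelCount T k g) → f i ≤ g i
  ≤-from {f} {g} antif antig eq with f i ≤? g i
  ... | yes fi≤gi = fi≤gi
  ... | no fi≰gi = ⊥-elim (<-irrefl refl (begin-strict
    i                     <⟨ levelCount-≥ antif T (f i) i i<T ≤-refl ⟩
    levelCount T (f i) f  ≡⟨ eq (f i) ⟩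
    levelCount T (f i) g  ≤⟨ levelCount-≤ antig T (f i) i (≰⇒> fi≰gi) ⟩
    i                     ∎))
    where open ≤-Reasoning

delayed : (ℕ → ℕ) → ℕ → ℕ → ℕ
delayed E s m = if s ≤ᵇ m then E (m ∸ s) else 0

delayed-as-sum : ∀ E s m → delayed E s m ≡ Σ< (suc m) (λ d → ind (d ≡ᵇ s) * E (m ∸ d))
delayed-as-sum E s m with s ≤ᵇ m in e
... | true = sym (Σ<-select (suc m) s (λ d → E (m ∸ d)) (s≤s (≤ᵇ-true⇒≤ s m e)))
... | false = sym (trans (Σ<-cong (suc m) vanish) (Σ<-zero (suc m)))
  where
  vanish : ∀ d → d < suc m → ind (d ≡ᵇ s) * E (m ∸ d) ≡ 0
  vanish d d≤m rewrite ≡ᵇ-false {d} {s} (<⇒≢ (≤-<-trans (≤-pred d≤m) (≤ᵇ-false⇒> s m e))) = refl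

sumMap-delayed : ∀ E m xs → sumMap (λ x → delayed E x m) xs ≡ Σ< (suc m) (λ d → count≡ d xs * E (m ∸ d))
sumMap-delayed E m xs = begin
  sumMap (λ x → delayed E x m) xs
    ≡⟨ sumMap-cong xs (λ x → delayed-as-sum E x m) ⟩
  sumMap (λ x → Σ< (suc m) (λ d → ind (d ≡ᵇ x) * E (m ∸ d))) xs
    ≡⟨ sumMap-Σ< (λ x d → ind (d ≡ᵇ x) * E (m ∸ d)) xs (suc m) ⟩
  Σ< (suc m) (λ d → sumMap (λ x → ind (d ≡ᵇ x) * E (m ∸ d)) xs)
    ≡⟨ Σ<-cong (suc m) (λ d _ → trans (sumMap-cong xs (λ x → *-comm (ind (d ≡ᵇ x)) (E (m ∸ d))))
         (trans (sumMap-*ˡ (E (m ∸ d)) (λ x → ind (d ≡ᵇ x)) xs) (*-comm (E (m ∸ d)) _))) ⟩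
  Σ< (suc m) (λ d → count≡ d xs * E (m ∸ d)) ∎
  where open ≡-Reasoning

-- The sums are the coefficients of (Σₓ zˣ) · (Σₑ E e zᵉ); a power series with E 0 = 1 can be cancelled.
delayed-sums-injective : ∀ (E : ℕ → ℕ) → E 0 ≡ 1 → ∀ xs ys →
  (∀ m → sumMap (λ x → delayed E x m) xs ≡ sumMap (λ x → delayed E x m) ys) →
  ∀ d → count≡ d xs ≡ count≡ d ys
delayed-sums-injective E E0≡1 xs ys eq d = go (suc d) d ≤-refl
  where
  go : ∀ m d → d < m → count≡ d xs ≡ count≡ d ys
  go (suc m) d (s≤s d≤m) with m ≟ d
  ... | no m≢d = go m d (≤∧≢⇒< d≤m (λ e → m≢d (sym e)))
  ... | yes refl = +-cancelˡ-≡ (lower xs) _ _ (begin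
    lower xs + count≡ m xs                      ≡⟨ sym (split xs) ⟩
    Σ< (suc m) (λ d → count≡ d xs * E (m ∸ d))  ≡⟨ sym (sumMap-delayed E m xs) ⟩
    sumMap (λ x → delayed E x m) xs             ≡⟨ eq m ⟩
    sumMap (λ x → delayed E x m) ys             ≡⟨ sumMap-delayed E m ys ⟩
    Σ< (suc m) (λ d → count≡ d ys * E (m ∸ d))  ≡⟨ split ys ⟩
    lower ys + count≡ m ys                      ≡⟨ cong (_+ count≡ m ys) (Σ<-cong m (λ d d<m → cong (_* E (m ∸ d)) (sym (go m d d<m)))) ⟩
    lower xs + count≡ m ys                      ∎)
    where
    open ≡-Reasoning
    lower : List ℕ → ℕ
    lower zs = Σ< m (λ d → count≡ d zs * E (m ∸ d))
    split : ∀ zs → Σ< (suc m) (λ d → count≡ d zs * E (m ∸ d)) ≡ lower zs + count≡ m zs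
    split zs = trans (Σ<-last m (λ d → count≡ d zs * E (m ∸ d)))
      (cong (lower zs +_) (trans (cong (λ e → count≡ m zs * E e) (n∸n≡0 m))
        (trans (cong (count≡ m zs *_) E0≡1) (*-identityʳ _))))

-- Compositions and the words dominating a given word

Σ∈↔Fin : (xs : List A) → Σ A (_∈ xs) ↔ Fin (length xs)
Σ∈↔Fin xs = mk↔ₛ′ (λ (_ , z∈) → Any.index z∈) (λ i → lookup xs i , ∈-lookup i) (index-lookup xs) (λ (_ , z∈) → lookup-index z∈)
  where
  index-lookup : (xs : List A) (i : Fin (length xs)) → Any.index (∈-lookup {xs = xs} i) ≡ i
  index-lookup (x ∷ xs) zero = refl
  index-lookup (x ∷ xs) (suc i) = cong suc (index-lookup xs i)
  lookup-index : {z : A} {xs : List A} (z∈ : z ∈ xs) →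
    _≡_ {A = Σ A (_∈ xs)} (lookup xs (Any.index z∈) , ∈-lookup (Any.index z∈)) (z , z∈)
  lookup-index (here refl) = refl
  lookup-index (there z∈) = cong (λ (y , y∈) → y , there y∈) (lookup-index z∈)

unique⇒∈-irrelevant : {z : A} {xs : List A} → Unique xs → (p q : z ∈ xs) → p ≡ q
unique⇒∈-irrelevant (_ ∷ _) (here refl) (here refl) = refl
unique⇒∈-irrelevant (x∉ ∷ _) (here refl) (there q) = ⊥-elim (All.lookup x∉ q refl)
unique⇒∈-irrelevant (x∉ ∷ _) (there p) (here refl) = ⊥-elim (All.lookup x∉ p refl)
unique⇒∈-irrelevant (_ ∷ u) (there p) (there q) = cong there (unique⇒∈-irrelevant u p q)

Σ-↔-prop : {P Q : A → Set} → (∀ x (a b : P x) → a ≡ b) → (∀ x (a b : Q x) → a ≡ b) →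
  (∀ x → P x → Q x) → (∀ x → Q x → P x) → Σ A P ↔ Σ A Q
Σ-↔-prop propP propQ f g = mk↔ₛ′ (λ (x , p) → x , f x p) (λ (x , q) → x , g x q)
  (λ (x , q) → cong (x ,_) (propQ x _ _)) (λ (x , p) → cong (x ,_) (propP x _ _))

unique-same-members⇒length≡ : {xs ys : List A} → Unique xs → Unique ys →
  (∀ z → z ∈ xs → z ∈ ys) → (∀ z → z ∈ ys → z ∈ xs) → length xs ≡ length ys
unique-same-members⇒length≡ {xs = xs} {ys} uxs uys f g = ↔⇒≡ (↔-trans (↔-sym (Σ∈↔Fin xs))
  (↔-trans (Σ-↔-prop (λ _ → unique⇒∈-irrelevant uxs) (λ _ → unique⇒∈-irrelevant uys) f g) (Σ∈↔Fin ys)))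

∈-map-all : {P : B → Set} {f : A → B} {xs : List A} →
  (∀ {x} → x ∈ xs → P (f x)) → ∀ {w} → w ∈ map f xs → P w
∈-map-all h = All.lookup (All.map⁺ (All.tabulate h))

IsComposition : ℕ → ℕ → List ℕ → Set
IsComposition l e w = length w ≡ l × sum w ≡ e

cons0 : ∀ {l e} x → IsComposition l e x → IsComposition (suc l) e (0 ∷ x)
cons0 _ (len , s) = cong suc len , s

incHead : List ℕ → List ℕ
incHead [] = []
incHead (x ∷ xs) = suc x ∷ xs

compositions : ℕ → ℕ → List (List ℕ)
compositions zero zero = [ [] ]
compositions zero (suc e) = []
compositions (suc l) zero = map (0 ∷_) (compositions l 0)
compositions (suc l) (suc e) = map (0 ∷_) (compositions l (suc e)) ++ map incHead (compositions (suc l) e)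

compositions-unique : ∀ l e → Unique (compositions l e)
compositions-unique zero zero = [] ∷ []
compositions-unique zero (suc e) = []
compositions-unique (suc l) zero = Unique.map⁺ ∷-injectiveʳ (compositions-unique l 0)
compositions-unique (suc l) (suc e) = Unique.++⁺ (Unique.map⁺ ∷-injectiveʳ (compositions-unique l (suc e)))
  (Unique.map⁺ incHead-injective (compositions-unique (suc l) e)) disjoint
  where
  incHead-injective : ∀ {x y} → incHead x ≡ incHead y → x ≡ y
  incHead-injective {[]} {[]} _ = refl
  incHead-injective {_ ∷ _} {_ ∷ _} refl = refl
  disjoint : Disjoint (map (0 ∷_) (compositions l (suc e))) (map incHead (compositions (suc l) e))
  disjoint (p , q) with ∈-map⁻ (0 ∷_) p | ∈-map⁻ incHead q
  ... | _ , _ , refl | [] , _ , ()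
  ... | _ , _ , refl | _ ∷ _ , _ , ()

∈-compositions⁻ : ∀ l e {w} → w ∈ compositions l e → IsComposition l e w
∈-compositions⁻ zero zero (here refl) = refl , refl
∈-compositions⁻ (suc l) zero = ∈-map-all {P = IsComposition (suc l) 0} (λ {x} x∈ → cons0 x (∈-compositions⁻ l 0 x∈))
∈-compositions⁻ (suc l) (suc e) w∈ with ∈-++⁻ (map (0 ∷_) (compositions l (suc e))) w∈
... | inj₁ w∈₁ = ∈-map-all {P = IsComposition (suc l) (suc e)} (λ {x} x∈ → cons0 x (∈-compositions⁻ l (suc e) x∈)) w∈₁
... | inj₂ w∈₂ = ∈-map-all {P = IsComposition (suc l) (suc e)} (λ {x} x∈ → inc x (∈-compositions⁻ (suc l) e x∈)) w∈₂
  where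
  inc : ∀ x → IsComposition (suc l) e x → IsComposition (suc l) (suc e) (incHead x)
  inc (_ ∷ _) (len , s) = len , cong suc s

∈-compositions⁺ : ∀ w → w ∈ compositions (length w) (sum w)
∈-compositions⁺ [] = here refl
∈-compositions⁺ (x ∷ xs) = cons x xs
  where
  cons : ∀ x xs → (x ∷ xs) ∈ compositions (suc (length xs)) (x + sum xs)
  cons zero xs with sum xs | ∈-compositions⁺ xs
  ... | zero | xs∈ = ∈-map⁺ (0 ∷_) xs∈
  ... | suc e | xs∈ = ∈-++⁺ˡ (∈-map⁺ (0 ∷_) xs∈)
  cons (suc x) xs = ∈-++⁺ʳ (map (0 ∷_) (compositions (length xs) (suc (x + sum xs)))) (∈-map⁺ incHead (cons x xs))

infixl 6 _⊕_ _⊖_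

_⊕_ : List ℕ → List ℕ → List ℕ
[] ⊕ x = x
(a ∷ p) ⊕ [] = []
(a ∷ p) ⊕ (y ∷ ys) = (a + y) ∷ (p ⊕ ys)

_⊖_ : List ℕ → List ℕ → List ℕ
w ⊖ [] = w
[] ⊖ (a ∷ p) = []
(y ∷ ys) ⊖ (a ∷ p) = (y ∸ a) ∷ (ys ⊖ p)

⊕-injectiveʳ : ∀ p {x y} → p ⊕ x ≡ p ⊕ y → x ≡ y
⊕-injectiveʳ [] e = e
⊕-injectiveʳ (a ∷ p) {[]} {[]} e = refl
⊕-injectiveʳ (a ∷ p) {x ∷ xs} {y ∷ ys} e =
  cong₂ _∷_ (+-cancelˡ-≡ a x y (∷-injectiveˡ e)) (⊕-injectiveʳ p (∷-injectiveʳ e))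

⊕-dominates : ∀ p x → length x ≡ length p → Pointwise _≤_ p (p ⊕ x)
⊕-dominates [] [] _ = []
⊕-dominates (a ∷ p) (y ∷ ys) e = m≤m+n a y ∷ ⊕-dominates p ys (suc-injective e)

sum-⊕ : ∀ p x → length x ≡ length p → sum (p ⊕ x) ≡ sum p + sum x
sum-⊕ [] [] _ = refl
sum-⊕ (a ∷ p) (y ∷ ys) e = trans (cong (a + y +_) (sum-⊕ p ys (suc-injective e))) (interchange a y (sum p) (sum ys))

⊕-⊖ : ∀ {p w} → Pointwise _≤_ p w → p ⊕ (w ⊖ p) ≡ w
⊕-⊖ [] = refl
⊕-⊖ (a≤y ∷ p≤w) = cong₂ _∷_ (m+[n∸m]≡n a≤y) (⊕-⊖ p≤w)

length-⊖ : ∀ {p w} → Pointwise _≤_ p w → length (w ⊖ p) ≡ length p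
length-⊖ [] = refl
length-⊖ (_ ∷ p≤w) = cong suc (length-⊖ p≤w)

sum-mono : ∀ {p w} → Pointwise _≤_ p w → sum p ≤ sum w
sum-mono [] = z≤n
sum-mono (a≤y ∷ p≤w) = +-mono-≤ a≤y (sum-mono p≤w)

dominating : List ℕ → ℕ → List (List ℕ)
dominating p m = if sum p ≤ᵇ m then map (p ⊕_) (compositions (length p) (m ∸ sum p)) else []

dominating-unique : ∀ p m → Unique (dominating p m)
dominating-unique p m with sum p ≤ᵇ m
... | true = Unique.map⁺ (⊕-injectiveʳ p) (compositions-unique (length p) (m ∸ sum p))
... | false = []

∈-dominating⁻ : ∀ p m {w} → w ∈ dominating p m → Pointwise _≤_ p w × sum w ≡ m
∈-dominating⁻ p m w∈ with sum p ≤ᵇ m in e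
... | true with ∈-map⁻ (p ⊕_) w∈
...   | x , x∈ , refl with ∈-compositions⁻ (length p) (m ∸ sum p) x∈
...     | len , s = ⊕-dominates p x len ,
  trans (sum-⊕ p x len) (trans (cong (sum p +_) s) (m+[n∸m]≡n (≤ᵇ-true⇒≤ (sum p) m e)))

∈-dominating⁺ : ∀ p m {w} → Pointwise _≤_ p w → sum w ≡ m → w ∈ dominating p m
∈-dominating⁺ p m {w} p≤w refl rewrite ≤ᵇ-true (sum-mono p≤w) =
  subst (_∈ map (p ⊕_) (compositions (length p) (sum w ∸ sum p))) (⊕-⊖ p≤w) (∈-map⁺ (p ⊕_) w⊖p∈)
  where
  sum-⊖ : sum (w ⊖ p) ≡ sum w ∸ sum p
  sum-⊖ = trans (sym (m+n∸m≡n (sum p) (sum (w ⊖ p))))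
    (cong (_∸ sum p) (trans (sym (sum-⊕ p (w ⊖ p) (length-⊖ p≤w))) (cong sum (⊕-⊖ p≤w))))
  w⊖p∈ : (w ⊖ p) ∈ compositions (length p) (sum w ∸ sum p)
  w⊖p∈ = subst₂ (λ l e → (w ⊖ p) ∈ compositions l e) (length-⊖ p≤w) sum-⊖ (∈-compositions⁺ (w ⊖ p))

#compositions : ℕ → ℕ → ℕ
#compositions l e = length (compositions l e)

length-dominating : ∀ p m → length (dominating p m) ≡ delayed (#compositions (length p)) (sum p) m
length-dominating p m with sum p ≤ᵇ m
... | true = length-map (p ⊕_) (compositions (length p) (m ∸ sum p))
... | false = refl

#compositions-zero : ∀ l → #compositions l 0 ≡ 1
#compositions-zero zero = refl
#compositions-zero (suc l) = trans (length-map (0 ∷_) (compositions l 0)) (#compositions-zero l)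

-- Coefficients of A_u, and the length of u

dominates?-sound : ∀ v u → dominates? v u ≡ true → Dominates v u
dominates?-sound v u e with decidable _≤?_ u v
... | yes u≤v = u≤v

dominates?-complete : ∀ {v u} → Dominates v u → dominates? v u ≡ true
dominates?-complete {v} {u} = dec-true (decidable _≤?_ u v)

dominates?-false : ∀ {v u} → ¬ Dominates v u → dominates? v u ≡ false
dominates?-false {v} {u} = dec-false (decidable _≤?_ u v)

positiveWords : ℕ → ℕ → List (List ℕ)
positiveWords L m = dominating (replicate L 1) m

coefficient : List ℕ → ℕ → ℕ → ℕ → ℕ
coefficient u L m k = length (filter (λ w → N u w ≟ k) (positiveWords L m))

IsPWord⇒dominates-1s : ∀ {w} → IsPWord w → Pointwise _≤_ (replicate (length w) 1) w
IsPWord⇒dominates-1s [] = []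
IsPWord⇒dominates-1s (1≤x ∷ pw) = 1≤x ∷ IsPWord⇒dominates-1s pw

dominates-1s⇒IsPWord : ∀ {L w} → Pointwise _≤_ (replicate L 1) w → IsPWord w
dominates-1s⇒IsPWord {zero} [] = []
dominates-1s⇒IsPWord {suc L} (1≤x ∷ rest) = 1≤x ∷ dominates-1s⇒IsPWord rest

∈-positiveWords⁻ : ∀ L m {w} → w ∈ positiveWords L m → IsPWord w × length w ≡ L × sum w ≡ m
∈-positiveWords⁻ L m w∈ with ∈-dominating⁻ (replicate L 1) m w∈
... | 1s≤w , s = dominates-1s⇒IsPWord 1s≤w , trans (sym (Pointwise-length 1s≤w)) (length-replicate L) , s

∈-positiveWords⁺ : ∀ {w} → IsPWord w → w ∈ positiveWords (length w) (sum w)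
∈-positiveWords⁺ pw = ∈-dominating⁺ _ _ (IsPWord⇒dominates-1s pw) refl

Coeff↔Fin : ∀ u L m k → Coeff u L m k ↔ Fin (coefficient u L m k)
Coeff↔Fin u L m k = ↔-trans (Σ-↔-prop irrelevant (λ _ → unique⇒∈-irrelevant unique) to from) (Σ∈↔Fin counted)
  where
  counted : List (List ℕ)
  counted = filter (λ w → N u w ≟ k) (positiveWords L m)
  unique : Unique counted
  unique = Unique.filter⁺ (λ w → N u w ≟ k) (dominating-unique (replicate L 1) m)
  Counted : List ℕ → Set
  Counted w = IsPWord w × length w ≡ L × sum w ≡ m × N u w ≡ k
  irrelevant : ∀ w (a b : Counted w) → a ≡ b
  irrelevant w (a₁ , a₂ , a₃ , a₄) (b₁ , b₂ , b₃ , b₄) =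
    cong₂ _,_ (All.irrelevant ≤-irrelevant a₁ b₁)
      (cong₂ _,_ (≡-irrelevant a₂ b₂) (cong₂ _,_ (≡-irrelevant a₃ b₃) (≡-irrelevant a₄ b₄)))
  to : ∀ w → Counted w → w ∈ counted
  to w (pw , refl , refl , Nw) = ∈-filter⁺ (λ w → N u w ≟ k) (∈-positiveWords⁺ pw) Nw
  from : ∀ w → w ∈ counted → Counted w
  from w w∈ with ∈-filter⁻ (λ w → N u w ≟ k) {xs = positiveWords L m} w∈
  ... | w∈′ , Nw with ∈-positiveWords⁻ L m w∈′
  ... | pw , len , s = pw , len , s , Nw

StronglyWilfEquivalent⇒coefficient≡ : ∀ {u v} → StronglyWilfEquivalent u v →
  ∀ L m k → coefficient u L m k ≡ coefficient v L m k
StronglyWilfEquivalent⇒coefficient≡ {u} {v} equiv L m k =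
  ↔⇒≡ (↔-trans (↔-sym (Coeff↔Fin u L m k)) (↔-trans (equiv L m k) (Coeff↔Fin v L m k)))

dominates?-length : ∀ v u → length v ≢ length u → dominates? v u ≡ false
dominates?-length v u v≢u = dominates?-false {v} {u} (λ v≥u → v≢u (sym (Pointwise-length v≥u)))

dominates?-short : ∀ u w → length w < length u → dominates? (take (length u) w) u ≡ false
dominates?-short u w w<u = dominates?-length (take (length u) w) u λ e →
  <⇒≢ w<u (trans (sym (m≥n⇒m⊓n≡n (<⇒≤ w<u))) (trans (sym (length-take (length u) w)) e))

N-short : ∀ u w → length w < length u → N u w ≡ 0
N-short u [] w<u rewrite dominates?-length [] u (<⇒≢ w<u) = refl
N-short u (a ∷ w) w<u rewrite dominates?-short u (a ∷ w) w<u = N-short u w (<-trans (n<1+n _) w<u)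

N-self : ∀ u → N u u ≡ 1
N-self [] = refl
N-self (a ∷ u) rewrite take-all (length u) u ≤-refl | dominates?-complete (Pointwise-refl ≤-refl {a ∷ u}) =
  cong suc (N-short (a ∷ u) u (n<1+n _))

N-pos⇒length≤ : ∀ u w → 1 ≤ N u w → length u ≤ length w
N-pos⇒length≤ u [] N≥1 with dominates? [] u in e
... | true = ≤-reflexive (Pointwise-length (dominates?-sound [] u e))
N-pos⇒length≤ u (a ∷ w) N≥1 with dominates? (take (length u) (a ∷ w)) u in e
... | true = ≤-trans (≤-reflexive (trans (Pointwise-length (dominates?-sound _ u e)) (length-take (length u) (a ∷ w)))) (m⊓n≤n _ _)
... | false = m≤n⇒m≤1+n (N-pos⇒length≤ u w N≥1)

-- The image of u (which has N u u = 1) under the bijection is a word of length |u| with a factor dominating v.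
StronglyWilfEquivalent⇒length≤ : ∀ {u v} → IsPWord u → StronglyWilfEquivalent u v → length v ≤ length u
StronglyWilfEquivalent⇒length≤ {u} {v} pu equiv with Inverse.to (equiv (length u) (sum u) 1) (u , pu , refl , refl , N-self u)
... | w , _ , len , _ , Nw = subst (length v ≤_) len (N-pos⇒length≤ v w (≤-reflexive (sym Nw)))

StronglyWilfEquivalent⇒length≡ : ∀ {u v} → IsPWord u → IsPWord v → StronglyWilfEquivalent u v → length u ≡ length v
StronglyWilfEquivalent⇒length≡ pu pv equiv = ≤-antisym
  (StronglyWilfEquivalent⇒length≤ pv (λ n m k → ↔-sym (equiv n m k)))
  (StronglyWilfEquivalent⇒length≤ pu equiv)

-- Placing copies of u: profiles and occurrences

countTrue : List Bool → ℕ
countTrue = sumMap ind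

countTrue≤length : ∀ bs → countTrue bs ≤ length bs
countTrue≤length [] = z≤n
countTrue≤length (b ∷ bs) = +-mono-≤ (ind≤1 b) (countTrue≤length bs)

countTrue-all : ∀ n → countTrue (replicate n true) ≡ n
countTrue-all zero = refl
countTrue-all (suc n) = cong suc (countTrue-all n)

-- Subset test on indicator lists; bits missing from K count as false.
_⊆ᵇ_ : List Bool → List Bool → Bool
[] ⊆ᵇ _ = true
(b ∷ S) ⊆ᵇ [] = not b ∧ (S ⊆ᵇ [])
(b ∷ S) ⊆ᵇ (c ∷ K) = (not b ∨ c) ∧ (S ⊆ᵇ K)

⊆ᵇ-all : ∀ S → (S ⊆ᵇ replicate (length S) true) ≡ true
⊆ᵇ-all [] = refl
⊆ᵇ-all (b ∷ S) rewrite ⊆ᵇ-all S with b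
... | true = refl
... | false = refl

subsets : ℕ → ℕ → List (List Bool)
subsets zero zero = [ [] ]
subsets zero (suc r) = []
subsets (suc J) zero = map (false ∷_) (subsets J zero)
subsets (suc J) (suc r) = map (true ∷_) (subsets J r) ++ map (false ∷_) (subsets J (suc r))

subsets-length : ∀ J r → All (λ S → length S ≡ J) (subsets J r)
subsets-length zero zero = refl ∷ []
subsets-length zero (suc r) = []
subsets-length (suc J) zero = All.map⁺ (All.map (cong suc) (subsets-length J zero))
subsets-length (suc J) (suc r) = All.++⁺ (All.map⁺ (All.map (cong suc) (subsets-length J r)))
  (All.map⁺ (All.map (cong suc) (subsets-length J (suc r))))

#subsets-⊆ : ∀ K r → sumMap (λ S → ind (S ⊆ᵇ K)) (subsets (length K) r) ≡ countTrue K C r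
#subsets-⊆ [] zero = refl
#subsets-⊆ [] (suc r) = refl
#subsets-⊆ (c ∷ K) zero = trans (sumMap-map (λ S → ind (S ⊆ᵇ (c ∷ K))) (false ∷_) (subsets (length K) zero)) (#subsets-⊆ K zero)
#subsets-⊆ (c ∷ K) (suc r) = begin
  sumMap F (map (true ∷_) (subsets (length K) r) ++ map (false ∷_) (subsets (length K) (suc r)))
    ≡⟨ sumMap-++ F (map (true ∷_) (subsets (length K) r)) _ ⟩
  sumMap F (map (true ∷_) (subsets (length K) r)) + sumMap F (map (false ∷_) (subsets (length K) (suc r)))
    ≡⟨ cong₂ _+_ (sumMap-map F (true ∷_) (subsets (length K) r)) (sumMap-map F (false ∷_) (subsets (length K) (suc r))) ⟩
  sumMap (λ S → ind (c ∧ (S ⊆ᵇ K))) (subsets (length K) r) + sumMap (λ S → ind (S ⊆ᵇ K)) (subsets (length K) (suc r))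
    ≡⟨ cong (sumMap (λ S → ind (c ∧ (S ⊆ᵇ K))) (subsets (length K) r) +_) (#subsets-⊆ K (suc r)) ⟩
  sumMap (λ S → ind (c ∧ (S ⊆ᵇ K))) (subsets (length K) r) + countTrue K C suc r
    ≡⟨ pascal c ⟩
  countTrue (c ∷ K) C suc r ∎
  where
  open ≡-Reasoning
  F : List Bool → ℕ
  F S = ind (S ⊆ᵇ (c ∷ K))
  pascal : ∀ c → sumMap (λ S → ind (c ∧ (S ⊆ᵇ K))) (subsets (length K) r) + countTrue K C suc r ≡ countTrue (c ∷ K) C suc r
  pascal true = trans (cong (_+ countTrue K C suc r) (#subsets-⊆ K r)) (nCk+nC[k+1]≡[n+1]C[k+1] (countTrue K) r)
  pascal false = cong (_+ countTrue K C suc r) (sumMap-zero (subsets (length K) r))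

length-subsets : ∀ J r → length (subsets J r) ≡ J C r
length-subsets J r = begin
  length (subsets J r)                                          ≡⟨ sym (trans (sumMap-const 1 (subsets J r)) (*-identityˡ _)) ⟩
  sumMap (λ _ → 1) (subsets J r)                                ≡⟨ sumMap-cong∈ (subsets J r) (λ S S∈ → cong ind (sym (⊆-all S S∈))) ⟩
  sumMap (λ S → ind (S ⊆ᵇ all)) (subsets J r)                   ≡⟨ cong (λ n → sumMap (λ S → ind (S ⊆ᵇ all)) (subsets n r)) (sym (length-replicate J)) ⟩
  sumMap (λ S → ind (S ⊆ᵇ all)) (subsets (length all) r)        ≡⟨ #subsets-⊆ all r ⟩
  countTrue all C r                                             ≡⟨ cong (_C r) (countTrue-all J) ⟩
  J C r                                                         ∎
  where
  open ≡-Reasoning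
  all : List Bool
  all = replicate J true
  ⊆-all : ∀ S → S ∈ subsets J r → (S ⊆ᵇ all) ≡ true
  ⊆-all S S∈ = subst (λ n → (S ⊆ᵇ replicate n true) ≡ true) (All.lookup (subsets-length J r) S∈) (⊆ᵇ-all S)

-- The p-th letter of u, or 1 (the least letter) beyond the end of u.
entry : List ℕ → ℕ → ℕ
entry [] p = 1
entry (c ∷ u) zero = c
entry (c ∷ u) (suc p) = entry u p

infix 4 _⊒_

_⊒_ : List ℕ → (ℕ → ℕ) → Set
w ⊒ f = Dominates w (applyUpTo f (length w))

IsPWord⇒⊒1 : ∀ {w} → IsPWord w → w ⊒ (λ _ → 1)
IsPWord⇒⊒1 [] = []
IsPWord⇒⊒1 (1≤x ∷ pw) = 1≤x ∷ IsPWord⇒⊒1 pw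

⊒⇒IsPWord : ∀ {f : ℕ → ℕ} w → (∀ p → 1 ≤ f p) → w ⊒ f → IsPWord w
⊒⇒IsPWord [] f≥1 [] = []
⊒⇒IsPWord (x ∷ w) f≥1 (fx≤x ∷ rest) = ≤-trans (f≥1 0) fx≤x ∷ ⊒⇒IsPWord w (λ p → f≥1 (suc p)) rest

⊒-⊔ : ∀ {f g : ℕ → ℕ} w → w ⊒ f → w ⊒ g → w ⊒ (λ p → f p ⊔ g p)
⊒-⊔ [] [] [] = []
⊒-⊔ (x ∷ w) (a ∷ as) (b ∷ bs) = ⊔-lub a b ∷ ⊒-⊔ w as bs

⊒-⊔ˡ : ∀ {f g : ℕ → ℕ} w → w ⊒ (λ p → f p ⊔ g p) → w ⊒ f
⊒-⊔ˡ [] [] = []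
⊒-⊔ˡ (x ∷ w) (a ∷ as) = ≤-trans (m≤m⊔n _ _) a ∷ ⊒-⊔ˡ w as

⊒-⊔ʳ : ∀ {f g : ℕ → ℕ} w → w ⊒ (λ p → f p ⊔ g p) → w ⊒ g
⊒-⊔ʳ [] [] = []
⊒-⊔ʳ (x ∷ w) (a ∷ as) = ≤-trans (m≤n⊔m _ _) a ∷ ⊒-⊔ʳ w as

dominates-prefix⇒⊒entry : ∀ u w → IsPWord w → Dominates (take (length u) w) u → w ⊒ entry u
dominates-prefix⇒⊒entry [] w pw _ = IsPWord⇒⊒1 pw
dominates-prefix⇒⊒entry (c ∷ u) (x ∷ w) (_ ∷ pw) (c≤x ∷ rest) = c≤x ∷ dominates-prefix⇒⊒entry u w pw rest

⊒entry⇒dominates-prefix : ∀ u w → length u ≤ length w → w ⊒ entry u → Dominates (take (length u) w) u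
⊒entry⇒dominates-prefix [] w _ _ = []
⊒entry⇒dominates-prefix (c ∷ u) (x ∷ w) (s≤s u≤w) (c≤x ∷ rest) = c≤x ∷ ⊒entry⇒dominates-prefix u w u≤w rest

later : (ℕ → ℕ) → ℕ → ℕ
later f zero = 1
later f (suc p) = f p

placed : Bool → List ℕ → ℕ → ℕ
placed b u p = if b then entry u p else 1

-- S lists, for each starting position j, whether a copy of u is placed there; profile u S p is the
-- largest letter any placed copy puts at position p, i.e. the least word dominating all of them.
profile : List ℕ → List Bool → ℕ → ℕ
profile u [] p = 1
profile u (b ∷ S) p = placed b u p ⊔ later (profile u S) p

1≤profile : ∀ u S p → 1 ≤ profile u S p
1≤profile u [] p = ≤-refl
1≤profile u (b ∷ S) zero = m≤n⊔m _ 1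
1≤profile u (b ∷ S) (suc p) = ≤-trans (1≤profile u S p) (m≤n⊔m _ _)

occurrences : List ℕ → ℕ → List ℕ → List Bool
occurrences u zero w = []
occurrences u (suc J) w = dominates? (take (length u) w) u ∷ occurrences u J (drop 1 w)

length-occurrences : ∀ u J w → length (occurrences u J w) ≡ J
length-occurrences u zero w = refl
length-occurrences u (suc J) w = cong suc (length-occurrences u J (drop 1 w))

⊆occurrences⇒⊒profile : ∀ u S w → IsPWord w → (S ⊆ᵇ occurrences u (length S) w) ≡ true → w ⊒ profile u S
⊆occurrences⇒⊒profile u [] w pw _ = IsPWord⇒⊒1 pw
⊆occurrences⇒⊒profile u (b ∷ S) [] _ _ = []
⊆occurrences⇒⊒profile u (b ∷ S) (c ∷ w) (1≤c ∷ pw) S⊆ =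
  ⊒-⊔ {placed b u} {later (profile u S)} (c ∷ w) (first b (∧-conicalˡ _ _ S⊆)) (1≤c ∷ ⊆occurrences⇒⊒profile u S w pw (∧-conicalʳ _ _ S⊆))
  where
  first : ∀ b → (not b ∨ dominates? (take (length u) (c ∷ w)) u) ≡ true → c ∷ w ⊒ placed b u
  first false _ = IsPWord⇒⊒1 (1≤c ∷ pw)
  first true d = dominates-prefix⇒⊒entry u (c ∷ w) (1≤c ∷ pw) (dominates?-sound _ u d)

⊒profile⇒⊆occurrences : ∀ u S w → 1 ≤ length u → length w + 1 ≡ length u + length S →
  w ⊒ profile u S → (S ⊆ᵇ occurrences u (length S) w) ≡ true
⊒profile⇒⊆occurrences u [] w _ _ _ = refl
⊒profile⇒⊆occurrences u (b ∷ S) [] 1≤u e _ = ⊥-elim (1+n≰n (subst (2 ≤_) (sym e) (+-mono-≤ 1≤u (s≤s (z≤n {length S})))))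
⊒profile⇒⊆occurrences u (b ∷ S) (c ∷ w) 1≤u e w⊒ = cong₂ _∧_ (first b (⊒-⊔ˡ {placed b u} {later (profile u S)} (c ∷ w) w⊒))
  (⊒profile⇒⊆occurrences u S w 1≤u e′ (tail (⊒-⊔ʳ {placed b u} {later (profile u S)} (c ∷ w) w⊒)))
  where
  e′ : length w + 1 ≡ length u + length S
  e′ = suc-injective (trans e (+-suc (length u) (length S)))
  tail : c ∷ w ⊒ later (profile u S) → w ⊒ profile u S
  tail (_ ∷ rest) = rest
  u≤w : length u ≤ length (c ∷ w)
  u≤w = subst (length u ≤_) (trans (sym e′) (+-comm (length w) 1)) (m≤m+n (length u) (length S))
  first : ∀ b → c ∷ w ⊒ placed b u → (not b ∨ dominates? (take (length u) (c ∷ w)) u) ≡ true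
  first false _ = refl
  first true w⊒u = dominates?-complete (⊒entry⇒dominates-prefix u (c ∷ w) u≤w w⊒u)

N≡countTrue-occurrences-all : ∀ u w → N u w ≡ countTrue (occurrences u (suc (length w)) w)
N≡countTrue-occurrences-all u [] =
  trans (sym (+-identityʳ _)) (cong (λ v → ind (dominates? v u) + 0) (sym (take-[] (length u))))
N≡countTrue-occurrences-all u (a ∷ w) = cong (ind (dominates? (take (length u) (a ∷ w)) u) +_) (N≡countTrue-occurrences-all u w)

countTrue-occurrences-+ : ∀ u J k w →
  countTrue (occurrences u (J + k) w) ≡ countTrue (occurrences u J w) + countTrue (occurrences u k (drop J w))
countTrue-occurrences-+ u zero k w = refl
countTrue-occurrences-+ u (suc J) k w rewrite countTrue-occurrences-+ u J k (drop 1 w) | drop-drop 1 J w =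
  sym (+-assoc (ind (dominates? (take (length u) w) u)) _ _)

countTrue-occurrences-short : ∀ u k w → length w < length u → countTrue (occurrences u k w) ≡ 0
countTrue-occurrences-short u zero w w<u = refl
countTrue-occurrences-short u (suc k) w w<u rewrite dominates?-short u w w<u =
  countTrue-occurrences-short u k (drop 1 w) (≤-<-trans (≤-trans (≤-reflexive (length-drop 1 w)) (m∸n≤m _ 1)) w<u)

-- A word of length L = |u| + J − 1 has exactly J starting positions for a factor of length |u|.
N≡countTrue-occurrences : ∀ u J w → 1 ≤ length u → length w + 1 ≡ length u + J →
  N u w ≡ countTrue (occurrences u J w)
N≡countTrue-occurrences u J w 1≤u e = begin
  N u w                                                                      ≡⟨ N≡countTrue-occurrences-all u w ⟩
  countTrue (occurrences u (suc (length w)) w)                               ≡⟨ cong (λ n → countTrue (occurrences u n w)) e′ ⟩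
  countTrue (occurrences u (J + length u) w)                                 ≡⟨ countTrue-occurrences-+ u J (length u) w ⟩
  countTrue (occurrences u J w) + countTrue (occurrences u (length u) (drop J w))
    ≡⟨ cong (countTrue (occurrences u J w) +_) (countTrue-occurrences-short u (length u) (drop J w) short) ⟩
  countTrue (occurrences u J w) + 0                                          ≡⟨ +-identityʳ _ ⟩
  countTrue (occurrences u J w)                                              ∎
  where
  open ≡-Reasoning
  e′ : suc (length w) ≡ J + length u
  e′ = trans (+-comm 1 (length w)) (trans e (+-comm (length u) J))
  short : length (drop J w) < length u
  short rewrite length-drop J w with J ≤? length w
  ... | no J≰w = subst (_< length u) (sym (m≤n⇒m∸n≡0 (<⇒≤ (≰⇒> J≰w)))) 1≤u
  ... | yes J≤w = ≤-reflexive (trans (sym (+-∸-assoc 1 J≤w))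
        (trans (cong (_∸ J) (trans (+-comm 1 (length w)) e)) (m+n∸n≡m (length u) J)))

-- Inclusion–exclusion over sets of occurrences

weight : List ℕ → ℕ → List Bool → ℕ
weight u L S = sum (applyUpTo (profile u S) L)

N<2+length : ∀ u w → N u w < suc (suc (length w))
N<2+length u w = s≤s (begin
  N u w                                             ≡⟨ N≡countTrue-occurrences-all u w ⟩
  countTrue (occurrences u (suc (length w)) w)      ≤⟨ countTrue≤length (occurrences u (suc (length w)) w) ⟩
  length (occurrences u (suc (length w)) w)         ≡⟨ length-occurrences u (suc (length w)) w ⟩
  suc (length w)                                    ∎)
  where open ≤-Reasoning

module _ (u : List ℕ) (1≤u : 1 ≤ length u) (J L : ℕ) (L+1≡u+J : L + 1 ≡ length u + J) (m : ℕ) where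

  private
    words : List (List ℕ)
    words = positiveWords L m

    length-words : ∀ {w} → w ∈ words → length w ≡ L
    length-words w∈ with ∈-positiveWords⁻ L m w∈
    ... | _ , len , _ = len

    -- Among the positive words, those whose occurrence set contains S are exactly the words dominating profile u S.
    #containing : ∀ S → length S ≡ J →
      sumMap (λ w → ind (S ⊆ᵇ occurrences u J w)) words ≡ delayed (#compositions L) (weight u L S) m
    #containing S refl = begin
      sumMap (λ w → ind (S ⊆ᵇ occurrences u J w)) words    ≡⟨ sym (length-filter (λ w → T? (S ⊆ᵇ occurrences u J w)) words) ⟩
      length (filter (λ w → T? (S ⊆ᵇ occurrences u J w)) words) ≡⟨ unique-same-members⇒length≡
           (Unique.filter⁺ (λ w → T? (S ⊆ᵇ occurrences u J w)) (dominating-unique (replicate L 1) m))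
           (dominating-unique P m) to from ⟩
      length (dominating P m)                                ≡⟨ length-dominating P m ⟩
      delayed (#compositions (length P)) (sum P) m           ≡⟨ cong (λ l → delayed (#compositions l) (sum P) m) (length-applyUpTo (profile u S) L) ⟩
      delayed (#compositions L) (weight u L S) m             ∎
      where
      open ≡-Reasoning
      P : List ℕ
      P = applyUpTo (profile u S) L
      to : ∀ w → w ∈ filter (λ w → T? (S ⊆ᵇ occurrences u J w)) words → w ∈ dominating P m
      to w w∈ with ∈-filter⁻ (λ w → T? (S ⊆ᵇ occurrences u J w)) {xs = words} w∈
      ... | w∈′ , S⊆ with ∈-positiveWords⁻ L m w∈′
      ... | pw , refl , s = ∈-dominating⁺ P m (⊆occurrences⇒⊒profile u S w pw (Equivalence.to T-≡ S⊆)) s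
      from : ∀ w → w ∈ dominating P m → w ∈ filter (λ w → T? (S ⊆ᵇ occurrences u J w)) words
      from w w∈ with ∈-dominating⁻ P m w∈
      ... | P≤w , s = ∈-filter⁺ (λ w → T? (S ⊆ᵇ occurrences u J w))
        (subst₂ (λ l s → w ∈ positiveWords l s) len s (∈-positiveWords⁺ pw))
        (Equivalence.from T-≡ (⊒profile⇒⊆occurrences u S w 1≤u (trans (cong (_+ 1) len) L+1≡u+J) w⊒P))
        where
        len : length w ≡ L
        len = trans (sym (Pointwise-length P≤w)) (length-applyUpTo (profile u S) L)
        w⊒P : w ⊒ profile u S
        w⊒P = subst (λ l → Dominates w (applyUpTo (profile u S) l)) (sym len) P≤w
        pw : IsPWord w
        pw = ⊒⇒IsPWord w (1≤profile u S) w⊒P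

  coefficient≡count≡ : ∀ k → coefficient u L m k ≡ count≡ k (map (N u) words)
  coefficient≡count≡ k = begin
    coefficient u L m k                          ≡⟨ length-filter (λ w → N u w ≟ k) words ⟩
    sumMap (λ w → ind (does (N u w ≟ k))) words  ≡⟨ sumMap-cong words (λ w → cong ind (≡ᵇ-sym (N u w) k)) ⟩
    sumMap (λ w → ind (k ≡ᵇ N u w)) words        ≡⟨ sym (sumMap-map (λ x → ind (k ≡ᵇ x)) (N u) words) ⟩
    count≡ k (map (N u) words)                   ∎
    where open ≡-Reasoning

  -- Counting pairs (w, S) with S an r-set of occurrences of u in w in two ways.
  binomial-moment-coefficients : ∀ r →
    Σ< (suc (suc L)) (λ k → (k C r) * coefficient u L m k) ≡ sumMap (λ S → delayed (#compositions L) (weight u L S) m) (subsets J r)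
  binomial-moment-coefficients r = begin
    Σ< (suc (suc L)) (λ k → (k C r) * coefficient u L m k)
      ≡⟨ Σ<-cong (suc (suc L)) (λ k _ → cong ((k C r) *_) (coefficient≡count≡ k)) ⟩
    Σ< (suc (suc L)) (λ k → (k C r) * count≡ k (map (N u) words))
      ≡⟨ Σ<-count≡ (suc (suc L)) r (map (N u) words) (All.map⁺ (All.tabulate N<2+L)) ⟩
    moment r (map (N u) words)
      ≡⟨ sumMap-map (_C r) (N u) words ⟩
    sumMap (λ w → N u w C r) words
      ≡⟨ sumMap-cong∈ words (λ w w∈ → cong (_C r) (N≡countTrue-occurrences u J w 1≤u (trans (cong (_+ 1) (length-words w∈)) L+1≡u+J))) ⟩
    sumMap (λ w → countTrue (occurrences u J w) C r) words
      ≡⟨ sumMap-cong words (λ w → sym (#subsets-⊆-occurrences w)) ⟩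
    sumMap (λ w → sumMap (λ S → ind (S ⊆ᵇ occurrences u J w)) (subsets J r)) words
      ≡⟨ sumMap-swap (λ w S → ind (S ⊆ᵇ occurrences u J w)) words (subsets J r) ⟩
    sumMap (λ S → sumMap (λ w → ind (S ⊆ᵇ occurrences u J w)) words) (subsets J r)
      ≡⟨ sumMap-cong∈ (subsets J r) (λ S S∈ → #containing S (All.lookup (subsets-length J r) S∈)) ⟩
    sumMap (λ S → delayed (#compositions L) (weight u L S) m) (subsets J r) ∎
    where
    open ≡-Reasoning
    N<2+L : ∀ {w} → w ∈ words → N u w < suc (suc L)
    N<2+L {w} w∈ = subst (λ l → N u w < suc (suc l)) (length-words w∈) (N<2+length u w)
    #subsets-⊆-occurrences : ∀ w → sumMap (λ S → ind (S ⊆ᵇ occurrences u J w)) (subsets J r) ≡ countTrue (occurrences u J w) C r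
    #subsets-⊆-occurrences w = subst (λ n → sumMap (λ S → ind (S ⊆ᵇ occurrences u J w)) (subsets n r) ≡ countTrue (occurrences u J w) C r)
      (length-occurrences u J w) (#subsets-⊆ (occurrences u J w) r)

-- The generating polynomial of the weights over r-sets S is recovered from the coefficients, and E 0 = 1 inverts it.
StronglyWilfEquivalent⇒weights↭ : ∀ {u v} → StronglyWilfEquivalent u v → 1 ≤ length u → length u ≡ length v →
  ∀ J L → L + 1 ≡ length u + J → ∀ r → map (weight u L) (subsets J r) ↭ map (weight v L) (subsets J r)
StronglyWilfEquivalent⇒weights↭ {u} {v} equiv 1≤u u≡v J L e r = count≡⇒↭ (weights u) (weights v)
  (delayed-sums-injective (#compositions L) (#compositions-zero L) (weights u) (weights v) delayed-sums≡)
  where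
  weights : List ℕ → List ℕ
  weights w = map (weight w L) (subsets J r)
  delayed-sums : List ℕ → ℕ → ℕ
  delayed-sums w m = sumMap (λ x → delayed (#compositions L) x m) (weights w)
  via-coefficients : ∀ w → 1 ≤ length w → L + 1 ≡ length w + J → ∀ m →
    delayed-sums w m ≡ Σ< (suc (suc L)) (λ k → (k C r) * coefficient w L m k)
  via-coefficients w 1≤w ew m = trans (sumMap-map (λ x → delayed (#compositions L) x m) (weight w L) (subsets J r))
    (sym (binomial-moment-coefficients w 1≤w J L ew m r))
  delayed-sums≡ : ∀ m → delayed-sums u m ≡ delayed-sums v m
  delayed-sums≡ m = trans (via-coefficients u 1≤u e m) (trans
    (Σ<-cong (suc (suc L)) (λ k _ → cong ((k C r) *_) (StronglyWilfEquivalent⇒coefficient≡ equiv L m k)))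
    (sym (via-coefficients v (subst (1 ≤_) u≡v 1≤u) (trans e (cong (_+ J) u≡v)) m)))

-- Levels and safe starting positions

-- Letters are ≥ 1, so a letter x ≤ T + 1 is 1 plus the number of levels i < T it lies above.
above : ℕ → ℕ → Bool
above i x = suc (suc i) ≤ᵇ x

≤ᵇ-⊔ : ∀ k x y → (k ≤ᵇ (x ⊔ y)) ≡ ((k ≤ᵇ x) ∨ (k ≤ᵇ y))
≤ᵇ-⊔ zero x y = refl
≤ᵇ-⊔ (suc k) zero y = refl
≤ᵇ-⊔ (suc k) (suc x) zero with k ≤ᵇ x
... | true = refl
... | false = refl
≤ᵇ-⊔ (suc k) (suc x) (suc y) = ≤ᵇ-⊔ k x y

above-placed : ∀ i b u p → above i (placed b u p) ≡ b ∧ above i (entry u p)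
above-placed i true u p = refl
above-placed i false u p = refl

de-morgan : ∀ b a t → (b ∧ a) ∨ not t ≡ not ((not b ∨ not a) ∧ t)
de-morgan true true t = refl
de-morgan true false t = refl
de-morgan false a t = refl

-- safe u J i p marks the starting positions j < J whose copy of u puts no letter ≥ i + 2 at position p.
safe : List ℕ → ℕ → ℕ → ℕ → List Bool
safe u zero i p = []
safe u (suc J) i zero = not (above i (entry u 0)) ∷ replicate J true
safe u (suc J) i (suc p) = not (above i (entry u (suc p))) ∷ safe u J i p

length-safe : ∀ u J i p → length (safe u J i p) ≡ J
length-safe u zero i p = refl
length-safe u (suc J) i zero = cong suc (length-replicate J)
length-safe u (suc J) i (suc p) = cong suc (length-safe u J i p)

#safe : List ℕ → ℕ → ℕ → ℕ → ℕ
#safe u J i p = countTrue (safe u J i p)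

above-profile : ∀ u S i p → above i (profile u S p) ≡ not (S ⊆ᵇ safe u (length S) i p)
above-profile u [] i p = refl
above-profile u (b ∷ S) i zero
  rewrite ≤ᵇ-⊔ (suc (suc i)) (placed b u 0) 1 | above-placed i b u 0 | ⊆ᵇ-all S = de-morgan b (above i (entry u 0)) true
above-profile u (b ∷ S) i (suc p)
  rewrite ≤ᵇ-⊔ (suc (suc i)) (placed b u (suc p)) (profile u S p) | above-placed i b u (suc p) | above-profile u S i p =
  de-morgan b (above i (entry u (suc p))) (S ⊆ᵇ safe u (length S) i p)

#subsets-above : ∀ u J r i p → sumMap (λ S → ind (above i (profile u S p))) (subsets J r) + #safe u J i p C r ≡ J C r
#subsets-above u J r i p = begin
  sumMap (λ S → ind (above i (profile u S p))) (subsets J r) + #safe u J i p C r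
    ≡⟨ cong₂ _+_ (sumMap-cong∈ (subsets J r) (λ S S∈ → cong ind (above-profile′ S (All.lookup (subsets-length J r) S∈))))
                 (sym #subsets-⊆-safe) ⟩
  sumMap (λ S → ind (not (S ⊆ᵇ K))) (subsets J r) + sumMap (λ S → ind (S ⊆ᵇ K)) (subsets J r)
    ≡⟨ sym (sumMap-+ (λ S → ind (not (S ⊆ᵇ K))) (λ S → ind (S ⊆ᵇ K)) (subsets J r)) ⟩
  sumMap (λ S → ind (not (S ⊆ᵇ K)) + ind (S ⊆ᵇ K)) (subsets J r)
    ≡⟨ sumMap-cong (subsets J r) (λ S → ind-not (S ⊆ᵇ K)) ⟩
  sumMap (λ _ → 1) (subsets J r)
    ≡⟨ trans (sumMap-const 1 (subsets J r)) (*-identityˡ _) ⟩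
  length (subsets J r)
    ≡⟨ length-subsets J r ⟩
  J C r ∎
  where
  open ≡-Reasoning
  K : List Bool
  K = safe u J i p
  above-profile′ : ∀ S → length S ≡ J → above i (profile u S p) ≡ not (S ⊆ᵇ K)
  above-profile′ S refl = above-profile u S i p
  #subsets-⊆-safe : sumMap (λ S → ind (S ⊆ᵇ K)) (subsets J r) ≡ countTrue K C r
  #subsets-⊆-safe = subst (λ n → sumMap (λ S → ind (S ⊆ᵇ K)) (subsets n r) ≡ countTrue K C r)
    (length-safe u J i p) (#subsets-⊆ K r)

entry≤ : ∀ u p → entry u p ≤ suc (sum u)
entry≤ [] p = s≤s z≤n
entry≤ (c ∷ u) zero = ≤-trans (m≤m+n c (sum u)) (n≤1+n _)
entry≤ (c ∷ u) (suc p) = ≤-trans (entry≤ u p) (s≤s (m≤n+m (sum u) c))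

profile≤ : ∀ u S p → profile u S p ≤ suc (sum u)
profile≤ u [] p = s≤s z≤n
profile≤ u (b ∷ S) p = ⊔-lub (placed≤ b) (later≤ p)
  where
  placed≤ : ∀ b → placed b u p ≤ suc (sum u)
  placed≤ true = entry≤ u p
  placed≤ false = s≤s z≤n
  later≤ : ∀ p → later (profile u S) p ≤ suc (sum u)
  later≤ zero = s≤s z≤n
  later≤ (suc p) = profile≤ u S p

levels : ∀ T x → 1 ≤ x → x ≤ suc T → x ≡ suc (Σ< T (λ i → ind (above i x)))
levels T (suc y) _ (s≤s y≤T) = cong suc (sym (count-below T y y≤T))
  where
  count-below : ∀ T y → y ≤ T → Σ< T (λ i → ind (suc i ≤ᵇ y)) ≡ y
  count-below T zero _ = Σ<-ind-none T (λ i → suc i ≤ᵇ zero) (λ _ _ → refl)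
  count-below (suc T) (suc y) (s≤s y≤T) = cong suc (count-below T y y≤T)

weight-levels : ∀ u L T S → sum u ≤ T → weight u L S ≡ L + Σ< L (λ p → Σ< T (λ i → ind (above i (profile u S p))))
weight-levels u L T S u≤T = begin
  sum (applyUpTo (profile u S) L)   ≡⟨ sum-applyUpTo (profile u S) L ⟩
  Σ< L (profile u S)                ≡⟨ Σ<-cong L (λ p _ → levels T (profile u S p) (1≤profile u S p) (≤-trans (profile≤ u S p) (s≤s u≤T))) ⟩
  Σ< L (λ p → 1 + H p)              ≡⟨ Σ<-+ L (λ _ → 1) H ⟩
  Σ< L (λ _ → 1) + Σ< L H           ≡⟨ cong (_+ Σ< L H) (trans (Σ<-const L 1) (*-identityʳ L)) ⟩
  L + Σ< L H                        ∎
  where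
  open ≡-Reasoning
  H : ℕ → ℕ
  H p = Σ< T (λ i → ind (above i (profile u S p)))

sumMap-weight+safe-moments : ∀ u J L T r → sum u ≤ T →
  sumMap (weight u L) (subsets J r) + Σ< L (λ p → Σ< T (λ i → #safe u J i p C r)) ≡ L * (J C r) + Σ< L (λ p → Σ< T (λ _ → J C r))
sumMap-weight+safe-moments u J L T r u≤T = begin
  sumMap (weight u L) (subsets J r) + Σ< L (λ p → Σ< T (Y p))
    ≡⟨ cong (_+ Σ< L (λ p → Σ< T (Y p))) weights ⟩
  (L * (J C r) + Σ< L (λ p → Σ< T (X p))) + Σ< L (λ p → Σ< T (Y p))
    ≡⟨ +-assoc (L * (J C r)) _ _ ⟩
  L * (J C r) + (Σ< L (λ p → Σ< T (X p)) + Σ< L (λ p → Σ< T (Y p)))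
    ≡⟨ cong (L * (J C r) +_) (sym (Σ<-+ L (λ p → Σ< T (X p)) (λ p → Σ< T (Y p)))) ⟩
  L * (J C r) + Σ< L (λ p → Σ< T (X p) + Σ< T (Y p))
    ≡⟨ cong (L * (J C r) +_) (Σ<-cong L (λ p _ → trans (sym (Σ<-+ T (X p) (Y p))) (Σ<-cong T (λ i _ → #subsets-above u J r i p)))) ⟩
  L * (J C r) + Σ< L (λ p → Σ< T (λ _ → J C r)) ∎
  where
  open ≡-Reasoning
  I : List Bool → ℕ → ℕ → ℕ
  I S p i = ind (above i (profile u S p))
  X Y : ℕ → ℕ → ℕ
  X p i = sumMap (λ S → I S p i) (subsets J r)
  Y p i = #safe u J i p C r
  weights : sumMap (weight u L) (subsets J r) ≡ L * (J C r) + Σ< L (λ p → Σ< T (X p))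
  weights = begin
    sumMap (weight u L) (subsets J r)
      ≡⟨ sumMap-cong (subsets J r) (λ S → weight-levels u L T S u≤T) ⟩
    sumMap (λ S → L + Σ< L (λ p → Σ< T (I S p))) (subsets J r)
      ≡⟨ sumMap-+ (λ _ → L) (λ S → Σ< L (λ p → Σ< T (I S p))) (subsets J r) ⟩
    sumMap (λ _ → L) (subsets J r) + sumMap (λ S → Σ< L (λ p → Σ< T (I S p))) (subsets J r)
      ≡⟨ cong₂ _+_ (trans (sumMap-const L (subsets J r)) (cong (L *_) (length-subsets J r)))
           (trans (sumMap-Σ< (λ S p → Σ< T (I S p)) (subsets J r) L)
             (Σ<-cong L (λ p _ → sumMap-Σ< (λ S → I S p) (subsets J r) T))) ⟩
    L * (J C r) + Σ< L (λ p → Σ< T (X p)) ∎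

safeCounts : List ℕ → ℕ → ℕ → ℕ → List ℕ
safeCounts u J L T = concat (applyUpTo (λ p → applyUpTo (λ i → #safe u J i p) T) L)

sumMap-safeCounts : ∀ f u J L T → sumMap f (safeCounts u J L T) ≡ Σ< L (λ p → Σ< T (λ i → f (#safe u J i p)))
sumMap-safeCounts f u J L T = begin
  sumMap f (concat (applyUpTo rows L))  ≡⟨ sumMap-concat f (applyUpTo rows L) ⟩
  sumMap (sumMap f) (applyUpTo rows L)  ≡⟨ sumMap-applyUpTo (sumMap f) rows L ⟩
  Σ< L (λ p → sumMap f (rows p))        ≡⟨ Σ<-cong L (λ p _ → sumMap-applyUpTo f (λ i → #safe u J i p) T) ⟩
  Σ< L (λ p → Σ< T (λ i → f (#safe u J i p))) ∎
  where
  open ≡-Reasoning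
  rows : ℕ → List ℕ
  rows p = applyUpTo (λ i → #safe u J i p) T

#safe≤ : ∀ u J i p → #safe u J i p ≤ J
#safe≤ u J i p = subst (#safe u J i p ≤_) (length-safe u J i p) (countTrue≤length (safe u J i p))

safeCounts≤ : ∀ u J L T → All (_≤ J) (safeCounts u J L T)
safeCounts≤ u J L T = All.concat⁺ (All.applyUpTo⁺₂ (λ p → applyUpTo (λ i → #safe u J i p) T) L
  (λ p → All.applyUpTo⁺₂ (λ i → #safe u J i p) T (λ i → #safe≤ u J i p)))

-- Moments of the safe counts are determined by the weights (sumMap-weight+safe-moments), hence by the coefficients.
StronglyWilfEquivalent⇒safeCounts-count≥ : ∀ {u v} → StronglyWilfEquivalent u v → 1 ≤ length u → length u ≡ length v →
  ∀ J L T → L + 1 ≡ length u + J → sum u ≤ T → sum v ≤ T →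
  ∀ k → count≥ k (safeCounts u J L T) ≡ count≥ k (safeCounts v J L T)
StronglyWilfEquivalent⇒safeCounts-count≥ {u} {v} equiv 1≤u u≡v J L T e u≤T v≤T =
  moments⇒count≥ J (safeCounts u J L T) (safeCounts v J L T) (safeCounts≤ u J L T) (safeCounts≤ v J L T) moments≡
  where
  moments≡ : ∀ r → moment r (safeCounts u J L T) ≡ moment r (safeCounts v J L T)
  moments≡ r = begin
    moment r (safeCounts u J L T)                   ≡⟨ sumMap-safeCounts (_C r) u J L T ⟩
    Σ< L (λ p → Σ< T (λ i → #safe u J i p C r))    ≡⟨ +-cancelˡ-≡ (sumMap (weight u L) (subsets J r)) _ _ (begin
      sumMap (weight u L) (subsets J r) + Σ< L (λ p → Σ< T (λ i → #safe u J i p C r))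
        ≡⟨ sumMap-weight+safe-moments u J L T r u≤T ⟩
      L * (J C r) + Σ< L (λ p → Σ< T (λ _ → J C r))
        ≡⟨ sym (sumMap-weight+safe-moments v J L T r v≤T) ⟩
      sumMap (weight v L) (subsets J r) + Σ< L (λ p → Σ< T (λ i → #safe v J i p C r))
        ≡⟨ cong (_+ Σ< L (λ p → Σ< T (λ i → #safe v J i p C r))) (sym weights≡) ⟩
      sumMap (weight u L) (subsets J r) + Σ< L (λ p → Σ< T (λ i → #safe v J i p C r)) ∎) ⟩
    Σ< L (λ p → Σ< T (λ i → #safe v J i p C r))    ≡⟨ sym (sumMap-safeCounts (_C r) v J L T) ⟩
    moment r (safeCounts v J L T)                   ∎
    where
    open ≡-Reasoning
    weights≡ : sumMap (weight u L) (subsets J r) ≡ sumMap (weight v L) (subsets J r)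
    weights≡ = trans (sym (sumMap-map (λ x → x) (weight u L) (subsets J r)))
      (trans (sumMap-↭ (λ x → x) (StronglyWilfEquivalent⇒weights↭ equiv 1≤u u≡v J L e r))
        (sumMap-map (λ x → x) (weight v L) (subsets J r)))

#safe-extend : ∀ u J i p → p < J → #safe u (suc J) i p ≡ suc (#safe u J i p)
#safe-extend u (suc J) i zero _ = +-suc (ind (not (above i (entry u 0)))) (countTrue (replicate J true))
#safe-extend u (suc J) i (suc p) (s≤s p<J) =
  trans (cong (ind (not (above i (entry u (suc p)))) +_) (#safe-extend u J i p p<J)) (+-suc _ _)

entry-beyond : ∀ u p → length u ≤ p → entry u p ≡ 1
entry-beyond [] p _ = refl
entry-beyond (c ∷ u) (suc p) (s≤s u≤p) = entry-beyond u p u≤p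

#safe-beyond : ∀ u J i p → length u ≤ suc p → #safe u (suc J) i (suc p) ≡ suc (#safe u J i p)
#safe-beyond u J i p u≤p rewrite entry-beyond u (suc p) u≤p = refl

-- Passing from J to J + 1 starting positions adds one safe position to every count, except that position n'
-- (the last one covered by the copy at 0) is duplicated.
Σ<-safe-shift : ∀ u n' → length u ≡ suc n' → ∀ J → suc n' ≤ J → ∀ i k →
  Σ< (n' + suc J) (λ p → ind (suc k ≤ᵇ #safe u (suc J) i p)) ≡ Σ< (n' + J) (λ p → ind (k ≤ᵇ #safe u J i p)) + ind (k ≤ᵇ #safe u J i n')
Σ<-safe-shift u n' lu J n'<J i k = begin
  Σ< (n' + suc J) F                                 ≡⟨ cong (λ n → Σ< n F) (+-suc n' J) ⟩
  Σ< (suc n' + J) F                                 ≡⟨ Σ<-split (suc n') J F ⟩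
  Σ< (suc n') F + Σ< J (λ q → F (suc n' + q))       ≡⟨ cong₂ _+_ (Σ<-cong (suc n') extend) (Σ<-cong J beyond) ⟩
  Σ< (suc n') G + Σ< J (λ q → G (n' + q))           ≡⟨ cong (_+ Σ< J (λ q → G (n' + q))) (Σ<-last n' G) ⟩
  (Σ< n' G + G n') + Σ< J (λ q → G (n' + q))        ≡⟨ xy∙z≈xz∙y (Σ< n' G) (G n') _ ⟩
  (Σ< n' G + Σ< J (λ q → G (n' + q))) + G n'        ≡⟨ cong (_+ G n') (sym (Σ<-split n' J G)) ⟩
  Σ< (n' + J) G + G n'                              ∎
  where
  open ≡-Reasoning
  F G : ℕ → ℕ
  F p = ind (suc k ≤ᵇ #safe u (suc J) i p)
  G p = ind (k ≤ᵇ #safe u J i p)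
  extend : ∀ p → p < suc n' → F p ≡ G p
  extend p p≤n' = cong (λ x → ind (suc k ≤ᵇ x)) (#safe-extend u J i p (≤-trans p≤n' n'<J))
  beyond : ∀ q → q < J → F (suc n' + q) ≡ G (n' + q)
  beyond q _ = cong (λ x → ind (suc k ≤ᵇ x))
    (#safe-beyond u J i (n' + q) (subst (_≤ suc (n' + q)) (sym lu) (s≤s (m≤m+n n' q))))

safeCounts-shift : ∀ u n' → length u ≡ suc n' → ∀ T J → suc n' ≤ J → ∀ k →
  count≥ (suc k) (safeCounts u (suc J) (n' + suc J) T) ≡ count≥ k (safeCounts u J (n' + J) T) + levelCount T k (λ i → #safe u J i n')
safeCounts-shift u n' lu T J n'<J k = begin
  count≥ (suc k) (safeCounts u (suc J) (n' + suc J) T)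
    ≡⟨ sumMap-safeCounts (λ x → ind (suc k ≤ᵇ x)) u (suc J) (n' + suc J) T ⟩
  Σ< (n' + suc J) (λ p → Σ< T (λ i → ind (suc k ≤ᵇ #safe u (suc J) i p)))
    ≡⟨ Σ<-swap (n' + suc J) T (λ p i → ind (suc k ≤ᵇ #safe u (suc J) i p)) ⟩
  Σ< T (λ i → Σ< (n' + suc J) (λ p → ind (suc k ≤ᵇ #safe u (suc J) i p)))
    ≡⟨ Σ<-cong T (λ i _ → Σ<-safe-shift u n' lu J n'<J i k) ⟩
  Σ< T (λ i → Σ< (n' + J) (λ p → G i p) + G i n')
    ≡⟨ Σ<-+ T (λ i → Σ< (n' + J) (G i)) (λ i → G i n') ⟩
  Σ< T (λ i → Σ< (n' + J) (G i)) + Σ< T (λ i → G i n')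
    ≡⟨ cong (_+ Σ< T (λ i → G i n')) (sym (Σ<-swap (n' + J) T (λ p i → G i p))) ⟩
  Σ< (n' + J) (λ p → Σ< T (λ i → G i p)) + Σ< T (λ i → G i n')
    ≡⟨ cong (_+ Σ< T (λ i → G i n')) (sym (sumMap-safeCounts (λ x → ind (k ≤ᵇ x)) u J (n' + J) T)) ⟩
  count≥ k (safeCounts u J (n' + J) T) + Σ< T (λ i → G i n') ∎
  where
  open ≡-Reasoning
  G : ℕ → ℕ → ℕ
  G i p = ind (k ≤ᵇ #safe u J i p)

-- Recovering the letter counts

count≥-zero : ∀ w → count≥ 0 w ≡ length w
count≥-zero [] = refl
count≥-zero (x ∷ w) = cong suc (count≥-zero w)

count≥-one : ∀ {w} → IsPWord w → count≥ 1 w ≡ length w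
count≥-one [] = refl
count≥-one {x ∷ w} (1≤x ∷ pw) = cong₂ _+_ (cong ind (≤ᵇ-true 1≤x)) (count≥-one pw)

count≥-vanish : ∀ t w → sum w < t → count≥ t w ≡ 0
count≥-vanish t [] _ = refl
count≥-vanish t (x ∷ w) x+w<t = cong₂ _+_ (cong ind (≤ᵇ-false (≤-<-trans (m≤m+n x (sum w)) x+w<t)))
  (count≥-vanish t w (≤-<-trans (m≤n+m (sum w) x) x+w<t))

count≥-as-Σ< : ∀ t w → count≥ t w ≡ Σ< (length w) (λ q → ind (t ≤ᵇ entry w q))
count≥-as-Σ< t [] = refl
count≥-as-Σ< t (c ∷ w) = cong (ind (t ≤ᵇ c) +_) (count≥-as-Σ< t w)

-- For p < J, the copies starting at j ≤ p put u_p, …, u_0 at position p; those starting at j > p are safe.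
#safe+Σ<above : ∀ u J i p → p < J → #safe u J i p + Σ< (suc p) (λ q → ind (above i (entry u q))) ≡ J
#safe+Σ<above u (suc J) i zero _ = begin
  ind (not a) + countTrue (replicate J true) + (ind a + 0) ≡⟨ cong (ind (not a) + countTrue (replicate J true) +_) (+-identityʳ (ind a)) ⟩
  ind (not a) + countTrue (replicate J true) + ind a       ≡⟨ xy∙z≈xz∙y (ind (not a)) _ (ind a) ⟩
  ind (not a) + ind a + countTrue (replicate J true)       ≡⟨ cong₂ _+_ (ind-not a) (countTrue-all J) ⟩
  suc J                                                    ∎
  where
  open ≡-Reasoning
  a : Bool
  a = above i (entry u 0)
#safe+Σ<above u (suc J) i (suc p) (s≤s p<J) = begin
  ind (not a) + #safe u J i p + Σ< (suc (suc p)) E        ≡⟨ cong (ind (not a) + #safe u J i p +_) (Σ<-last (suc p) E) ⟩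
  ind (not a) + #safe u J i p + (Σ< (suc p) E + ind a)    ≡⟨ cong (ind (not a) + #safe u J i p +_) (+-comm (Σ< (suc p) E) (ind a)) ⟩
  ind (not a) + #safe u J i p + (ind a + Σ< (suc p) E)    ≡⟨ interchange (ind (not a)) (#safe u J i p) (ind a) (Σ< (suc p) E) ⟩
  ind (not a) + ind a + (#safe u J i p + Σ< (suc p) E)    ≡⟨ cong₂ _+_ (ind-not a) (#safe+Σ<above u J i p p<J) ⟩
  suc J                                                   ∎
  where
  open ≡-Reasoning
  E : ℕ → ℕ
  E q = ind (above i (entry u q))
  a : Bool
  a = above i (entry u (suc p))

≤ᵇ-complement : ∀ J k c s → s + c ≡ J → k ≤ J → ind (k ≤ᵇ c) + ind (suc (J ∸ k) ≤ᵇ s) ≡ 1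
≤ᵇ-complement .(s + c) k c s refl k≤J with k ≤? c
... | yes k≤c rewrite ≤ᵇ-true k≤c
  | ≤ᵇ-false {suc (s + c ∸ k)} {s} (s≤s (subst (_≤ s + c ∸ k) (m+n∸n≡m s c) (∸-monoʳ-≤ (s + c) k≤c))) = refl
... | no k≰c rewrite ≤ᵇ-false {k} {c} (≰⇒> k≰c)
  | ≤ᵇ-true {suc (s + c ∸ k)} {s} (subst (s + c ∸ k <_) (m+n∸n≡m s c) (∸-monoʳ-< (≰⇒> k≰c) k≤J)) = refl

count≥≤length : ∀ t w → count≥ t w ≤ length w
count≥≤length t [] = z≤n
count≥≤length t (x ∷ w) = +-mono-≤ (ind≤1 (t ≤ᵇ x)) (count≥≤length t w)

module _ {u v : List ℕ} (pu : IsPWord u) (pv : IsPWord v) (equiv : StronglyWilfEquivalent u v)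
         (n : ℕ) (lu : length u ≡ suc n) (lv : length v ≡ suc n) where

  private
    T : ℕ
    T = sum u + sum v

    safeCounts≡ : ∀ J k → count≥ k (safeCounts u J (n + J) T) ≡ count≥ k (safeCounts v J (n + J) T)
    safeCounts≡ J = StronglyWilfEquivalent⇒safeCounts-count≥ equiv (subst (1 ≤_) (sym lu) (s≤s z≤n)) (trans lu (sym lv))
      J (n + J) T (trans (+-comm (n + J) 1) (cong (_+ J) (sym lu))) (m≤m+n (sum u) (sum v)) (m≤n+m (sum v) (sum u))

    middle : List ℕ → ℕ → ℕ
    middle w k = levelCount T k (λ i → #safe w (suc n) i n)

    middle≡ : ∀ k → middle u k ≡ middle v k
    middle≡ k = +-cancelˡ-≡ (count≥ k (safeCounts u (suc n) (n + suc n) T)) _ _ (begin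
      count≥ k (safeCounts u (suc n) (n + suc n) T) + middle u k       ≡⟨ sym (safeCounts-shift u n lu T (suc n) ≤-refl k) ⟩
      count≥ (suc k) (safeCounts u (suc (suc n)) (n + suc (suc n)) T)  ≡⟨ safeCounts≡ (suc (suc n)) (suc k) ⟩
      count≥ (suc k) (safeCounts v (suc (suc n)) (n + suc (suc n)) T)  ≡⟨ safeCounts-shift v n lv T (suc n) ≤-refl k ⟩
      count≥ k (safeCounts v (suc n) (n + suc n) T) + middle v k       ≡⟨ cong (_+ middle v k) (sym (safeCounts≡ (suc n) k)) ⟩
      count≥ k (safeCounts u (suc n) (n + suc n) T) + middle v k       ∎)
      where open ≡-Reasoning

    #above : List ℕ → ℕ → ℕ
    #above w i = count≥ (suc (suc i)) w

    -- With J = |w| starting positions, position n has #safe = |w| − #above, so each level i is counted on exactly one side.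
    levelCount+middle : ∀ w → length w ≡ suc n → ∀ k → k ≤ suc n → levelCount T k (#above w) + middle w (suc (suc n ∸ k)) ≡ T
    levelCount+middle w lw k k≤n = begin
      levelCount T k (#above w) + middle w (suc (suc n ∸ k))
        ≡⟨ sym (Σ<-+ T (λ i → ind (k ≤ᵇ #above w i)) (λ i → ind (suc (suc n ∸ k) ≤ᵇ #safe w (suc n) i n))) ⟩
      Σ< T (λ i → ind (k ≤ᵇ #above w i) + ind (suc (suc n ∸ k) ≤ᵇ #safe w (suc n) i n))
        ≡⟨ Σ<-cong T (λ i _ → ≤ᵇ-complement (suc n) k (#above w i) (#safe w (suc n) i n) (#safe+#above i) k≤n) ⟩
      Σ< T (λ _ → 1)
        ≡⟨ trans (Σ<-const T 1) (*-identityʳ T) ⟩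
      T ∎
      where
      open ≡-Reasoning
      #safe+#above : ∀ i → #safe w (suc n) i n + #above w i ≡ suc n
      #safe+#above i = trans (cong (#safe w (suc n) i n +_) (trans (count≥-as-Σ< (suc (suc i)) w)
        (cong (λ l → Σ< l (λ q → ind (above i (entry w q)))) lw))) (#safe+Σ<above w (suc n) i n ≤-refl)

    levelCount-vanish : ∀ w → length w ≡ suc n → ∀ k → suc n < k → levelCount T k (#above w) ≡ 0
    levelCount-vanish w lw k n<k = Σ<-ind-none T (λ i → k ≤ᵇ #above w i)
      (λ i _ → ≤ᵇ-false (≤-<-trans (subst (#above w i ≤_) lw (count≥≤length (suc (suc i)) w)) n<k))

    levelCount≡ : ∀ k → levelCount T k (#above u) ≡ levelCount T k (#above v)
    levelCount≡ k with k ≤? suc n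
    ... | yes k≤n = +-cancelʳ-≡ (middle u (suc (suc n ∸ k))) _ _ (trans (levelCount+middle u lu k k≤n)
          (sym (trans (cong (levelCount T k (#above v) +_) (middle≡ (suc (suc n ∸ k)))) (levelCount+middle v lv k k≤n))))
    ... | no k≰n = trans (levelCount-vanish u lu k (≰⇒> k≰n)) (sym (levelCount-vanish v lv k (≰⇒> k≰n)))

    #above-antitone : ∀ w → Antitone (#above w)
    #above-antitone w i = sumMap-mono w (ind-≤ᵇ-suc (suc (suc i)))

    count≥≡ : ∀ t → count≥ t u ≡ count≥ t v
    count≥≡ zero = trans (count≥-zero u) (trans lu (sym (trans (count≥-zero v) lv)))
    count≥≡ (suc zero) = trans (count≥-one pu) (trans lu (sym (trans (count≥-one pv) lv)))
    count≥≡ (suc (suc i)) with i <? T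
    ... | yes i<T = antitone-levelCount-injective (#above-antitone u) (#above-antitone v) T levelCount≡ i i<T
    ... | no i≮T = trans (count≥-vanish _ u (s≤s (≤-trans (m≤m+n (sum u) (sum v)) (≤-trans (≮⇒≥ i≮T) (n≤1+n i)))))
                     (sym (count≥-vanish _ v (s≤s (≤-trans (m≤n+m (sum v) (sum u)) (≤-trans (≮⇒≥ i≮T) (n≤1+n i))))))

  StronglyWilfEquivalent⇒↭ : u ↭ v
  StronglyWilfEquivalent⇒↭ = count≥⇒↭ u v count≥≡

theorem1 : (u v : List ℕ) → IsPWord u → IsPWord v →
    StronglyWilfEquivalent u v → u ↭ v
theorem1 [] [] _ _ _ = ↭-refl
theorem1 [] (b ∷ v) pu pv equiv with () ← StronglyWilfEquivalent⇒length≡ pu pv equiv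
theorem1 (a ∷ u) [] pu pv equiv with () ← StronglyWilfEquivalent⇒length≡ pu pv equiv
theorem1 (a ∷ u) (b ∷ v) pu pv equiv =
  StronglyWilfEquivalent⇒↭ pu pv equiv (length u) refl (sym (StronglyWilfEquivalent⇒length≡ pu pv equiv))
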